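{- Let $G=(V,E,\alpha,\beta)$ be a connected vertex-weighted graph with $\alpha,\beta:V\to\mathbb{N}$, let $(A,B)$ be a split of $(V,E)$, and let $C=N_G(B)\subseteq A$, $D=N_G(A)\subseteq B$, $a\in C$, $b\in D$. Let $G_A$ be the induced subgraph $G[A\cup\{b\}]$ with weights $\alpha_A(v)=\alpha(v)$, $\beta_A(v)=\beta(v)$ for $v\in A$, $\alpha_A(b)=\sum_{u\in D}\alpha(u)$, $\beta_A(b)=\sum_{u\in B}\beta(u)$, and let $G_B$ be $G[B\cup\{a\}]$ with weights $\alpha_B(u)=\alpha(u)$, $\beta_B(u)=\beta(u)$ for $u\in B$, $\alpha_B(a)=\sum_{v\in C}\alpha(v)$, $\beta_B(a)=\sum_{v\in A}\beta(v)$. Then for every $v\in A$, $$BC_G(v)=BC_{G_A}(v)+[v\in C]\cdot BC_{G_B}(a),$$ where $[v\in C]$ equals $1$ if $v\in C$ and $0$ otherwise.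
   Context: A split of a connected graph is a bipartition $(A,B)$ of the vertex set with $\min\{|A|,|B|\}\ge2$ such that every vertex of $N(A)$ is adjacent to every vertex of $N(B)$. For a vertex-weighted graph $H=(V,E,\alpha,\beta)$: the cost of a path is the product of $\alpha$ over its vertices; $\sigma_H(s,t)$ is the sum of the costs of all shortest $st$-paths, and $\sigma_H(s,t,v)$ the sum of the costs of the shortest $st$-paths containing $v$; the betweenness centrality is $BC_H(v)=\frac{1}{\alpha(v)}\sum_{s,t\in V\setminus v}\beta(s)\beta(t)\frac{\sigma_H(s,t,v)}{\sigma_H(s,t)}$. -}

module Defs where

open import Data.Bool using (Bool; true; false; _∧_; _∨_; not; if_then_else_; T)
open import Data.Nat using (ℕ; zero; suc; _≤_) renaming (_+_ to _+ℕ_; _*_ to _*ℕ_)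
open import Data.Fin using (Fin; _≟_)
open import Data.Vec using (Vec; []; _∷_; head; last)
open import Data.List using (List; []; _∷_; map; concatMap; allFin; foldr; length; upTo)
open import Data.Nat.ListAction using (sum)
open import Data.Bool.ListAction using (any)
open import Data.Integer using (+_)
open import Data.Rational using (ℚ; 0ℚ; 1ℚ; _/_) renaming (_+_ to _+ℚ_; _*_ to _*ℚ_)
open import Data.Product using (Σ; _×_)
open import Relation.Nullary.Decidable using (⌊_⌋)
open import Relation.Binary.PropositionalEquality using (_≡_; _≢_)

_==_ : ∀ {n} → Fin n → Fin n → Bool
v == w = ⌊ v ≟ w ⌋

filt : ∀ {A : Set} → (A → Bool) → List A → List A
filt p [] = []
filt p (x ∷ xs) = if p x then x ∷ filt p xs else filt p xs

-- A vertex-weighted graph whose vertex set is the subset {v | vert v ≡ true} of Fin n,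
-- with edges given by adj restricted to that vertex set.
record WGraph (n : ℕ) : Set where
  field
    vert : Fin n → Bool
    adj  : Fin n → Fin n → Bool
    α    : Fin n → ℕ
    β    : Fin n → ℕ
open WGraph public

IsSimple : ∀ {n} → (Fin n → Fin n → Bool) → Set
IsSimple {n} adj = (∀ u w → adj u w ≡ adj w u) × (∀ u → adj u u ≡ false)

vecs : ∀ n k → List (Vec (Fin n) k)
vecs n zero = [] ∷ []
vecs n (suc k) = concatMap (λ v → map (v ∷_) (vecs n k)) (allFin n)

isWalk : ∀ {n k} → WGraph n → Vec (Fin n) (suc k) → Bool
isWalk H (v ∷ []) = vert H v
isWalk H (v ∷ w ∷ ws) = vert H v ∧ adj H v w ∧ isWalk H (w ∷ ws)


walksK : ∀ {n} → WGraph n → (k : ℕ) → Fin n → Fin n → List (Vec (Fin n) (suc k))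
walksK {n} H k s t = filt (λ w → isWalk H w ∧ (head w == s) ∧ (last w == t)) (vecs n (suc k))

-- distance: least k ≤ n such that an st-walk with k edges exists (n+1 if none)
searchDist : ∀ {n} → WGraph n → Fin n → Fin n → List ℕ → ℕ
searchDist {n} H s t [] = suc n
searchDist H s t (k ∷ ks) with walksK H k s t
... | [] = searchDist H s t ks
... | _ ∷ _ = k

dist : ∀ {n} → WGraph n → Fin n → Fin n → ℕ
dist {n} H s t = searchDist H s t (upTo (suc n))

-- shortest st-paths = st-walks with dist(s,t) edges
shortestPaths : ∀ {n} → (H : WGraph n) → (s t : Fin n) → List (Vec (Fin n) (suc (dist H s t)))
shortestPaths H s t = walksK H (dist H s t) s t

cost : ∀ {n k} → WGraph n → Vec (Fin n) k → ℕ
cost H [] = 1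
cost H (v ∷ vs) = α H v *ℕ cost H vs

contains : ∀ {n k} → Fin n → Vec (Fin n) k → Bool
contains v [] = false
contains v (w ∷ ws) = (v == w) ∨ contains v ws

σ : ∀ {n} → WGraph n → Fin n → Fin n → ℕ
σ H s t = sum (map (cost H) (shortestPaths H s t))

σv : ∀ {n} → WGraph n → Fin n → Fin n → Fin n → ℕ
σv H s t v = sum (map (cost H) (filt (contains v) (shortestPaths H s t)))

-- p / q as a rational (total: value 0 when q = 0; never used with q = 0 under the hypotheses)
frac : ℕ → ℕ → ℚ
frac p zero = 0ℚ
frac p (suc q) = (+ p) / suc q

sumℚ : List ℚ → ℚ
sumℚ = foldr _+ℚ_ 0ℚ

pairs : ∀ {A : Set} → List A → List (A × A)
pairs xs = concatMap (λ s → map (λ t → s Data.Product., t) xs) xs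

BC : ∀ {n} → WGraph n → Fin n → ℚ
BC {n} H v =
  frac 1 (α H v) *ℚ
  sumℚ (map (λ st → frac (β H (Data.Product.proj₁ st) *ℕ β H (Data.Product.proj₂ st)
                           *ℕ σv H (Data.Product.proj₁ st) (Data.Product.proj₂ st) v)
                          (σ H (Data.Product.proj₁ st) (Data.Product.proj₂ st)))
        (filt (λ st → vert H (Data.Product.proj₁ st) ∧ vert H (Data.Product.proj₂ st)
                      ∧ not (Data.Product.proj₁ st == v) ∧ not (Data.Product.proj₂ st == v))
              (pairs (allFin n))))

Connected : ∀ {n} → WGraph n → Set
Connected H = ∀ s t → T (vert H s) → T (vert H t) →
  Σ ℕ λ k → Σ (Vec _ (suc k)) λ w → T (isWalk H w) × head w ≡ s × last w ≡ t

inN : ∀ {n} → (Fin n → Fin n → Bool) → (Fin n → Bool) → Fin n → Bool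
inN {n} adj S u = not (S u) ∧ any (λ w → S w ∧ adj u w) (allFin n)

count : ∀ {n} → (Fin n → Bool) → ℕ
count {n} S = length (filt S (allFin n))

-- (A, complement of A) is a split of the graph on Fin n with adjacency adj
IsSplit : ∀ {n} → (Fin n → Fin n → Bool) → (Fin n → Bool) → Set
IsSplit adj A =
  2 ≤ count A × 2 ≤ count (λ v → not (A v)) ×
  (∀ u w → T (inN adj A u) → T (inN adj (λ x → not (A x)) w) → T (adj u w))

sumOver : ∀ {n} → (Fin n → Bool) → (Fin n → ℕ) → ℕ
sumOver {n} S f = sum (map f (filt S (allFin n)))

GA : ∀ {n} → WGraph n → (Fin n → Bool) → Fin n → WGraph n
GA G A b = record
  { vert = λ v → A v ∨ (v == b)
  ; adj  = adj G
  ; α    = λ v → if v == b then sumOver (inN (adj G) A) (α G) else α G v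
  ; β    = λ v → if v == b then sumOver (λ x → not (A x)) (β G) else β G v
  }

GB : ∀ {n} → WGraph n → (Fin n → Bool) → Fin n → WGraph n
GB G A a = record
  { vert = λ v → not (A v) ∨ (v == a)
  ; adj  = adj G
  ; α    = λ v → if v == a then sumOver (inN (adj G) (λ x → not (A x))) (α G) else α G v
  ; β    = λ v → if v == a then sumOver A (β G) else β G v
  }

module Submission where

open import Defs
open import Data.Bool using (Bool; true; T; if_then_else_; not)
open import Data.Nat using (ℕ; NonZero)
open import Data.Fin using (Fin)
open import Data.Rational using (ℚ; 0ℚ; 1ℚ) renaming (_+_ to _+ℚ_; _*_ to _*ℚ_)
open import Relation.Binary.PropositionalEquality using (_≡_)
import Relation.Binary.PropositionalEquality as Eq
open import Algebra.Bundles using (Semiring)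
open import Level using (0ℓ)

-- The total cost of the st-walks with k edges is the walk sum W α k s t, given by
-- the first-step recursion W ω (k+1) s t = ω s · Σ_{w ~ s} W ω k w t (WalkSums).  Hence
-- σ(s,t) = W α d s t for d = dist(s,t), and σ(s,t,v) = σ(s,t) − W α' d s t where α' is α
-- with α(v) set to 0.  With positive weights, dist(s,t) is the least d with W ≠ 0 (Distance).
--
-- Fix a target t and write ℓ s = dist(s,t).  A walk of exactly ℓ s steps descends one
-- layer per step, so W restricted to ℓ s steps obeys a layered recursion (DistanceLayers).
-- For a split (P, Q) with t ∈ P, every shortest walk from Q leaves Q through the boundary
-- BQ = N(P), all at one common distance; so walk sums from BQ factor through one boundary
-- factor Kf, and contracting Q to a single vertex of weight Σ_BQ ω changes no walk sum
-- from P (SplitSide).  Applied with t ∈ A and with t ∈ B (SplitInstance), this gives for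
-- every pair (s,t) the relation between its terms in BC_G(v), BC_{G_A}(v) and BC_{G_B}(a).
--
-- Splitting the double sums for BC_G(v) and BC_{G_A}(v) into the blocks
-- A×A, A×B, B×A, B×B (with b for B in G_A) and comparing block by block (Comparison) gives
--   BC_G(v) = BC_{G_A}(v) + [v ∈ C]·BC_{G_B}(a),
-- since the B×B block of G is κ/ΣC times that of G_B with κ = [v ∈ C]·α(v), ΣC = α_B(a).

module FinEquality where

  open import Data.Bool using (true; false)
  open import Data.Empty using (⊥-elim)
  open import Data.Fin as F using (Fin; _≟_)
  import Data.Fin.Properties as FP
  open import Relation.Nullary using (yes; no; ¬_)
  open import Relation.Binary.PropositionalEquality

  ==-refl : ∀ {n} (s : Fin n) → (s == s) ≡ true
  ==-refl s with s ≟ s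
  ... | yes _ = refl
  ... | no s≢s = ⊥-elim (s≢s refl)

  ==-≡ : ∀ {n} {s t : Fin n} → (s == t) ≡ true → s ≡ t
  ==-≡ {s = s} {t} e with s ≟ t
  ... | yes p = p
  ==-≡ () | no _

  ==-≢ : ∀ {n} {s t : Fin n} → ¬ s ≡ t → (s == t) ≡ false
  ==-≢ {s = s} {t} s≢t with s ≟ t
  ... | yes p = ⊥-elim (s≢t p)
  ... | no _ = refl

  ==-sym : ∀ {n} (s t : Fin n) → (s == t) ≡ (t == s)
  ==-sym s t with s ≟ t | t ≟ s
  ... | yes _ | yes _ = refl
  ... | no _  | no _  = refl
  ... | yes p | no q  = ⊥-elim (q (sym p))
  ... | no p  | yes q = ⊥-elim (p (sym q))

  ==-suc : ∀ {n} (i s : Fin n) → (F.suc i == F.suc s) ≡ (i == s)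
  ==-suc i s with F.suc i ≟ F.suc s | i ≟ s
  ... | yes _ | yes _ = refl
  ... | no _  | no _  = refl
  ... | yes p | no q  = ⊥-elim (q (FP.suc-injective p))
  ... | no p  | yes q = ⊥-elim (p (cong F.suc q))

module SemiringSums (R : Semiring 0ℓ 0ℓ) where

  open Semiring R
  open import Data.Bool using (Bool; true; false; if_then_else_)
  open import Data.Nat using (zero; suc)
  open import Data.Fin as F using (Fin)
  open FinEquality using (==-suc; ==-sym)
  open import Data.List using (List; []; _∷_; map; concatMap; allFin; tabulate; _++_; foldr)
  open import Data.Product using (_×_; _,_)
  open import Function using (_∘_)
  open import Relation.Binary.PropositionalEquality as ≡ using (_≡_)
  open import Relation.Binary.Reasoning.Setoid setoid

  open import Algebra.Properties.Semiring.Sum R public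
    renaming (sum to ∑) using (sum-cong-≗; sum-replicate-zero; ∑-distrib-+; ∑-comm; *-distribˡ-sum; *-distribʳ-sum)

  listSum : ∀ {X : Set} → (X → Carrier) → List X → Carrier
  listSum f xs = foldr _+_ 0# (map f xs)

  ∑-δ : ∀ {n} (s : Fin n) (f : Fin n → Carrier) → ∑ (λ i → if i == s then f i else 0#) ≈ f s
  ∑-δ {suc n} F.zero f = begin
    f F.zero + ∑ {n} (λ _ → 0#) ≈⟨ +-congˡ (sum-replicate-zero n) ⟩
    f F.zero + 0#            ≈⟨ +-identityʳ _ ⟩
    f F.zero                 ∎
  ∑-δ {suc n} (F.suc s) f = begin
    0# + ∑ (λ i → if F.suc i == F.suc s then f (F.suc i) else 0#)
      ≈⟨ +-identityˡ _ ⟩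
    ∑ (λ i → if F.suc i == F.suc s then f (F.suc i) else 0#)
      ≡⟨ sum-cong-≗ (λ i → ≡.cong (λ c → if c then f (F.suc i) else 0#) (==-suc i s)) ⟩
    ∑ (λ i → if i == s then f (F.suc i) else 0#)
      ≈⟨ ∑-δ s (f ∘ F.suc) ⟩
    f (F.suc s) ∎

  ∑-guard : ∀ {n} (c : Bool) (f : Fin n → Carrier) → ∑ (λ i → if c then f i else 0#) ≈ (if c then ∑ f else 0#)
  ∑-guard true f = refl
  ∑-guard {n} false f = sum-replicate-zero n

  listSum-cong : ∀ {X : Set} {f g : X → Carrier} (xs : List X) → (∀ x → f x ≈ g x) → listSum f xs ≈ listSum g xs
  listSum-cong [] e = refl
  listSum-cong (x ∷ xs) e = +-cong (e x) (listSum-cong xs e)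

  listSum-filt : ∀ {X : Set} (f : X → Carrier) (p : X → Bool) (xs : List X) →
    listSum f (filt p xs) ≈ listSum (λ x → if p x then f x else 0#) xs
  listSum-filt f p [] = refl
  listSum-filt f p (x ∷ xs) with p x
  ... | true = +-congˡ (listSum-filt f p xs)
  ... | false = trans (listSum-filt f p xs) (sym (+-identityˡ _))

  listSum-++ : ∀ {X : Set} (f : X → Carrier) (xs ys : List X) → listSum f (xs ++ ys) ≈ listSum f xs + listSum f ys
  listSum-++ f [] ys = sym (+-identityˡ _)
  listSum-++ f (x ∷ xs) ys = trans (+-congˡ (listSum-++ f xs ys)) (sym (+-assoc (f x) _ _))

  listSum-concatMap : ∀ {X Y : Set} (f : Y → Carrier) (g : X → List Y) (xs : List X) →
    listSum f (concatMap g xs) ≈ listSum (λ x → listSum f (g x)) xs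
  listSum-concatMap f g [] = refl
  listSum-concatMap f g (x ∷ xs) = trans (listSum-++ f (g x) (concatMap g xs)) (+-congˡ (listSum-concatMap f g xs))

  listSum-map : ∀ {X Y : Set} (f : Y → Carrier) (h : X → Y) (xs : List X) → listSum f (map h xs) ≈ listSum (f ∘ h) xs
  listSum-map f h [] = refl
  listSum-map f h (x ∷ xs) = +-congˡ (listSum-map f h xs)

  listSum-+ : ∀ {X : Set} (f g : X → Carrier) (xs : List X) → listSum (λ x → f x + g x) xs ≈ listSum f xs + listSum g xs
  listSum-+ f g [] = sym (+-identityˡ 0#)
  listSum-+ f g (x ∷ xs) = begin
    (f x + g x) + listSum (λ x → f x + g x) xs   ≈⟨ +-congˡ (listSum-+ f g xs) ⟩
    (f x + g x) + (listSum f xs + listSum g xs) ≈⟨ +-assoc _ _ _ ⟩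
    f x + (g x + (listSum f xs + listSum g xs)) ≈⟨ +-congˡ (sym (+-assoc _ _ _)) ⟩
    f x + ((g x + listSum f xs) + listSum g xs) ≈⟨ +-congˡ (+-congʳ (+-comm _ _)) ⟩
    f x + ((listSum f xs + g x) + listSum g xs) ≈⟨ +-congˡ (+-assoc _ _ _) ⟩
    f x + (listSum f xs + (g x + listSum g xs)) ≈⟨ sym (+-assoc _ _ _) ⟩
    (f x + listSum f xs) + (g x + listSum g xs) ∎

  listSum-guard : ∀ {X : Set} (c : Bool) (f : X → Carrier) (xs : List X) →
    listSum (λ x → if c then f x else 0#) xs ≈ (if c then listSum f xs else 0#)
  listSum-guard true f xs = refl
  listSum-guard false f [] = refl
  listSum-guard false f (x ∷ xs) = trans (+-identityˡ _) (listSum-guard false f xs)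

  *-distribˡ-listSum : ∀ {X : Set} (c : Carrier) (f : X → Carrier) (xs : List X) →
    c * listSum f xs ≈ listSum (λ x → c * f x) xs
  *-distribˡ-listSum c f [] = zeroʳ c
  *-distribˡ-listSum c f (x ∷ xs) = trans (distribˡ c (f x) _) (+-congˡ (*-distribˡ-listSum c f xs))

  listSum-tabulate : ∀ {n} {X : Set} (f : X → Carrier) (h : Fin n → X) → listSum f (tabulate h) ≈ ∑ (f ∘ h)
  listSum-tabulate {zero} f h = refl
  listSum-tabulate {suc n} f h = +-congˡ (listSum-tabulate f (h ∘ F.suc))

  listSum-allFin : ∀ {n} (f : Fin n → Carrier) → listSum f (allFin n) ≈ ∑ f
  listSum-allFin f = listSum-tabulate f (λ i → i)

  listSum-∑ : ∀ {n} {X : Set} (f : X → Fin n → Carrier) (xs : List X) →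
    listSum (λ x → ∑ (f x)) xs ≈ ∑ (λ i → listSum (λ x → f x i) xs)
  listSum-∑ {n} f [] = sym (sum-replicate-zero n)
  listSum-∑ f (x ∷ xs) = trans (+-congˡ (listSum-∑ f xs)) (sym (∑-distrib-+ (f x) _))

  listSum-group : ∀ {n} {X : Set} (h : X → Fin n) (f : X → Carrier) (xs : List X) →
    listSum f xs ≈ ∑ (λ w → listSum (λ x → if h x == w then f x else 0#) xs)
  listSum-group h f xs = trans (listSum-cong xs (λ x → sym (label x)))
                               (listSum-∑ (λ x w → if h x == w then f x else 0#) xs)
    where
    label : ∀ x → ∑ (λ w → if h x == w then f x else 0#) ≈ f x
    label x = trans (reflexive (sum-cong-≗ (λ w → ≡.cong (λ c → if c then f x else 0#) (==-sym (h x) w))))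
                    (∑-δ (h x) (λ _ → f x))

  listSum-pairs : ∀ {n} (g : Fin n × Fin n → Carrier) → listSum g (pairs (allFin n)) ≈ ∑ (λ s → ∑ (λ t → g (s , t)))
  listSum-pairs {n} g = begin
    listSum g (pairs (allFin n))
      ≈⟨ listSum-concatMap g (λ s → map (s ,_) (allFin n)) (allFin n) ⟩
    listSum (λ s → listSum g (map (s ,_) (allFin n))) (allFin n)
      ≈⟨ listSum-cong (allFin n) (λ s → trans (listSum-map g (s ,_) (allFin n)) (listSum-allFin {n} _)) ⟩
    listSum (λ s → ∑ (λ t → g (s , t))) (allFin n)
      ≈⟨ listSum-allFin {n} _ ⟩
    ∑ (λ s → ∑ (λ t → g (s , t))) ∎

module NatSums where

  open import Data.Empty using (⊥-elim)
  open import Data.Nat as ℕ using (ℕ; zero; suc; _+_; _*_; _≤_)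
  import Data.Nat.Properties as NP
  open import Data.Fin as F using (Fin)
  open import Data.Bool using (Bool; true; false; if_then_else_)
  open import Data.Product using (_,_; ∃)
  open import Function using (_∘_)
  open import Relation.Nullary using (yes; no; ¬_)
  open import Relation.Binary.PropositionalEquality

  open SemiringSums NP.+-*-semiring public

  ∑-nonzero : ∀ {n} (f : Fin n → ℕ) → ¬ ∑ f ≡ 0 → ∃ λ i → ¬ f i ≡ 0
  ∑-nonzero {zero} f ∑≢0 = ⊥-elim (∑≢0 refl)
  ∑-nonzero {suc n} f ∑≢0 with f F.zero ℕ.≟ 0
  ... | no f0≢0 = F.zero , f0≢0
  ... | yes f0≡0 with ∑-nonzero (f ∘ F.suc) (λ e → ∑≢0 (cong₂ _+_ f0≡0 e))
  ... | i , fi≢0 = F.suc i , fi≢0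

  ∑-≥ : ∀ {n} (f : Fin n → ℕ) (i : Fin n) → f i ≤ ∑ f
  ∑-≥ {suc n} f F.zero = NP.m≤m+n _ _
  ∑-≥ {suc n} f (F.suc i) = NP.≤-trans (∑-≥ (f ∘ F.suc) i) (NP.m≤n+m _ (f F.zero))

  opaque
    ∑-split : ∀ {n} (p : Fin n → Bool) (f : Fin n → ℕ) →
      ∑ f ≡ ∑ (λ w → if p w then f w else 0) + ∑ (λ w → if p w then 0 else f w)
    ∑-split p f = trans (sum-cong-≗ (λ w → by-cases (p w))) (∑-distrib-+ (λ w → if p w then f w else 0) (λ w → if p w then 0 else f w))
      where by-cases : ∀ b {x} → x ≡ (if b then x else 0) + (if b then 0 else x)
            by-cases true = sym (NP.+-identityʳ _)
            by-cases false = refl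

    ∑-guard-*ʳ : ∀ {n} (c : Bool) (g : Fin n → ℕ) (K : ℕ) → ∑ (λ w → if c then g w * K else 0) ≡ (if c then ∑ g * K else 0)
    ∑-guard-*ʳ true g K = sym (*-distribʳ-sum K g)
    ∑-guard-*ʳ {n} false g K = sum-replicate-zero n

module Fractions where

  open import Data.Empty using (⊥-elim)
  open import Data.Nat as ℕ using (ℕ; zero; suc)
  import Data.Nat.Properties as NP
  open import Data.Nat.Solver using () renaming (module +-*-Solver to ℕ-Solver)
  open import Data.Integer using (+_)
  import Data.Integer as ℤ
  import Data.Integer.Properties as ℤP
  open import Data.Rational using (0ℚ; toℚᵘ) renaming (_+_ to _+ℚ_; _*_ to _*ℚ_)
  import Data.Rational.Properties as QP
  open import Data.Rational.Unnormalised as U using (ℚᵘ; mkℚᵘ; *≡*; _≃_)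
  import Data.Rational.Unnormalised.Properties as UP
  open import Relation.Nullary using (¬_)
  open import Relation.Binary.PropositionalEquality

  -- The unnormalised fraction a / (1 + b); `frac a (suc b)` normalises it.
  private
    fracᵘ : ℕ → ℕ → ℚᵘ
    fracᵘ a b = mkℚᵘ (+ a) b

    fracᵘ-≃ : ∀ a b c d → a ℕ.* suc d ≡ c ℕ.* suc b → fracᵘ a b ≃ fracᵘ c d
    fracᵘ-≃ a b c d e = *≡* (begin
      + a ℤ.* + suc d   ≡⟨ ℤP.pos-* a (suc d) ⟨
      + (a ℕ.* suc d)   ≡⟨ cong +_ e ⟩
      + (c ℕ.* suc b)   ≡⟨ ℤP.pos-* c (suc b) ⟩
      + c ℤ.* + suc b   ∎)
      where open ≡-Reasoning

    toℚᵘ-frac : ∀ a b → toℚᵘ (frac a (suc b)) ≃ fracᵘ a b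
    toℚᵘ-frac a b = QP.toℚᵘ-fromℚᵘ (fracᵘ a b)

    fracᵘ-+ : ∀ a b c d →
      (fracᵘ a b U.+ fracᵘ c d) ≃ fracᵘ (a ℕ.* suc d ℕ.+ c ℕ.* suc b) (ℕ.pred (suc b ℕ.* suc d))
    fracᵘ-+ a b c d = *≡* (cong (ℤ._* (+ suc (ℕ.pred (suc b ℕ.* suc d))))
      (trans (cong₂ ℤ._+_ (sym (ℤP.pos-* a (suc d))) (sym (ℤP.pos-* c (suc b))))
             (sym (ℤP.pos-+ (a ℕ.* suc d) (c ℕ.* suc b)))))

    fracᵘ-* : ∀ a b c d → (fracᵘ a b U.* fracᵘ c d) ≃ fracᵘ (a ℕ.* c) (ℕ.pred (suc b ℕ.* suc d))
    fracᵘ-* a b c d = *≡* (cong (ℤ._* (+ suc (ℕ.pred (suc b ℕ.* suc d)))) (sym (ℤP.pos-* a c)))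

    open UP.≃-Reasoning

    frac-+-suc : ∀ a c b → frac a (suc b) +ℚ frac c (suc b) ≡ frac (a ℕ.+ c) (suc b)
    frac-+-suc a c b = QP.toℚᵘ-injective (begin
      toℚᵘ (frac a (suc b) +ℚ frac c (suc b))
        ≈⟨ QP.toℚᵘ-homo-+ (frac a (suc b)) (frac c (suc b)) ⟩
      toℚᵘ (frac a (suc b)) U.+ toℚᵘ (frac c (suc b))
        ≈⟨ UP.+-cong (toℚᵘ-frac a b) (toℚᵘ-frac c b) ⟩
      fracᵘ a b U.+ fracᵘ c b
        ≈⟨ fracᵘ-+ a b c b ⟩
      fracᵘ (a ℕ.* suc b ℕ.+ c ℕ.* suc b) (ℕ.pred (suc b ℕ.* suc b))
        ≈⟨ fracᵘ-≃ _ _ _ _ (cross a b c) ⟩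
      fracᵘ (a ℕ.+ c) b
        ≈⟨ UP.≃-sym (toℚᵘ-frac (a ℕ.+ c) b) ⟩
      toℚᵘ (frac (a ℕ.+ c) (suc b)) ∎)
      where
      open ℕ-Solver
      cross : ∀ a b c → (a ℕ.* suc b ℕ.+ c ℕ.* suc b) ℕ.* suc b ≡ (a ℕ.+ c) ℕ.* (suc b ℕ.* suc b)
      cross = solve 3 (λ a b c → (a :* (con 1 :+ b) :+ c :* (con 1 :+ b)) :* (con 1 :+ b)
                               := (a :+ c) :* ((con 1 :+ b) :* (con 1 :+ b))) refl

    frac-*-suc : ∀ a b c d → frac a (suc b) *ℚ frac c (suc d) ≡ frac (a ℕ.* c) (suc b ℕ.* suc d)
    frac-*-suc a b c d = QP.toℚᵘ-injective (begin
      toℚᵘ (frac a (suc b) *ℚ frac c (suc d))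
        ≈⟨ QP.toℚᵘ-homo-* (frac a (suc b)) (frac c (suc d)) ⟩
      toℚᵘ (frac a (suc b)) U.* toℚᵘ (frac c (suc d))
        ≈⟨ UP.*-cong (toℚᵘ-frac a b) (toℚᵘ-frac c d) ⟩
      fracᵘ a b U.* fracᵘ c d
        ≈⟨ fracᵘ-* a b c d ⟩
      fracᵘ (a ℕ.* c) (ℕ.pred (suc b ℕ.* suc d))
        ≈⟨ UP.≃-sym (toℚᵘ-frac (a ℕ.* c) (ℕ.pred (suc b ℕ.* suc d))) ⟩
      toℚᵘ (frac (a ℕ.* c) (suc b ℕ.* suc d)) ∎)

  opaque
    frac-0 : ∀ q → frac 0 q ≡ 0ℚ
    frac-0 zero = refl
    frac-0 (suc q) = QP.0/n≡0 (suc q)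

    frac-+ : ∀ p p' q → frac (p ℕ.+ p') q ≡ frac p q +ℚ frac p' q
    frac-+ p p' zero = refl
    frac-+ p p' (suc q) = sym (frac-+-suc p p' q)

    frac-* : ∀ p q p' q' → frac p q *ℚ frac p' q' ≡ frac (p ℕ.* p') (q ℕ.* q')
    frac-* p zero p' q' = QP.*-zeroˡ (frac p' q')
    frac-* p (suc q) p' zero rewrite NP.*-zeroʳ q = QP.*-zeroʳ (frac p (suc q))
    frac-* p (suc q) p' (suc q') = frac-*-suc p q p' q'

    frac-cross : ∀ p q p' q' → ¬ q ≡ 0 → ¬ q' ≡ 0 → p ℕ.* q' ≡ p' ℕ.* q → frac p q ≡ frac p' q'
    frac-cross p zero p' q' q≢0 _ _ = ⊥-elim (q≢0 refl)
    frac-cross p (suc q) p' zero _ q'≢0 _ = ⊥-elim (q'≢0 refl)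
    frac-cross p (suc q) p' (suc q') _ _ e = QP.fromℚᵘ-cong (fracᵘ-≃ p q p' q' e)

module RationalSums where

  open Fractions
  open NatSums using () renaming (∑ to ∑ℕ)
  open import Algebra.Bundles using (CommutativeRing)
  open import Data.Nat using (ℕ; zero; suc)
  open import Data.Fin as F using (Fin)
  open import Data.Rational using () renaming (_+_ to _+ℚ_)
  import Data.Rational.Properties as QP
  open import Function using (_∘_)
  open import Relation.Binary.PropositionalEquality

  open SemiringSums (CommutativeRing.semiring QP.+-*-commutativeRing) public
    using () renaming
    ( ∑ to ∑ℚ; sum-cong-≗ to ∑ℚ-cong; ∑-distrib-+ to ∑ℚ-+; *-distribˡ-sum to ∑ℚ-*ˡ; ∑-comm to ∑ℚ-comm
    ; ∑-δ to ∑ℚ-δ; ∑-guard to ∑ℚ-guard; listSum-filt to listSumℚ-filt; listSum-pairs to listSumℚ-pairs)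

  opaque
    ∑ℚ-frac : ∀ {n} (f : Fin n → ℕ) K → ∑ℚ (λ s → frac (f s) K) ≡ frac (∑ℕ f) K
    ∑ℚ-frac {zero} f K = sym (frac-0 K)
    ∑ℚ-frac {suc n} f K = trans (cong (frac (f F.zero) K +ℚ_) (∑ℚ-frac (f ∘ F.suc) K)) (sym (frac-+ (f F.zero) _ K))

module WalkSums where

  open NatSums
  open FinEquality
  open import Data.Bool using (Bool; true; false; _∧_; not; if_then_else_)
  open import Data.Nat using (ℕ; zero; suc; _+_; _*_)
  import Data.Nat.Properties as NP
  open import Data.Fin using (Fin; _≟_)
  open import Data.Vec using (Vec; []; _∷_; head; last)
  open import Data.List using (List; map; allFin)
  open import Relation.Nullary using (yes; no)
  open import Relation.Binary.PropositionalEquality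
  open ≡-Reasoning

  -- W ω k s t is the sum over all walks s = x₀ x₁ … x_k = t (consecutive vertices adjacent)
  -- of ω x₀ * … * ω x_k, computed by the first-step recursion.
  module _ {n : ℕ} (adj : Fin n → Fin n → Bool) where
    W : (Fin n → ℕ) → ℕ → Fin n → Fin n → ℕ
    W ω zero s t = if s == t then ω s else 0
    W ω (suc k) s t = ω s * ∑ (λ w → if adj s w then W ω k w t else 0)

  -- The vertex weight α of H, set to 0 outside the vertex set of H; walks through
  -- vertices outside H then contribute nothing to W.
  weight : ∀ {n} → WGraph n → Fin n → ℕ
  weight H x = if vert H x then α H x else 0

  isStWalk : ∀ {n k} → WGraph n → Fin n → Fin n → Vec (Fin n) (suc k) → Bool
  isStWalk H s t w = isWalk H w ∧ (head w == s) ∧ (last w == t)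

  restrict : ∀ {X : Set} → (X → Bool) → (X → ℕ) → X → ℕ
  restrict p f x = if p x then f x else 0

  opaque
    restrict-singleton : ∀ {n} (H : WGraph n) (s t v : Fin n) →
      restrict (isStWalk H s t) (cost H) (v ∷ []) ≡ (if v == s then (if s == t then weight H s else 0) else 0)
    restrict-singleton H s t v with v ≟ s
    restrict-singleton H s t v | no _ with vert H v
    ... | true = refl
    ... | false = refl
    restrict-singleton H s t .s | yes refl with s ≟ t | vert H s
    ... | yes refl | true = NP.*-identityʳ _
    ... | yes refl | false = refl
    ... | no _ | true = refl
    ... | no _ | false = refl

  private
    guards-* : ∀ (a b c d e : Bool) (x y : ℕ) → (if (a ∧ b ∧ c) ∧ d ∧ e then x * y else 0) ≡
      (if d then (if a then x else 0) * (if b then (if c ∧ true ∧ e then y else 0) else 0) else 0)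
    guards-* a b c false e x y with a ∧ b ∧ c
    ... | true = refl
    ... | false = refl
    guards-* false b c true e x y = refl
    guards-* true false c true e x y = sym (NP.*-zeroʳ x)
    guards-* true true false true e x y = sym (NP.*-zeroʳ x)
    guards-* true true true true false x y = sym (NP.*-zeroʳ x)
    guards-* true true true true true x y = refl

  opaque
    restrict-cons : ∀ {n k} (H : WGraph n) (s t v : Fin n) (r : Vec (Fin n) (suc k)) →
      restrict (isStWalk H s t) (cost H) (v ∷ r) ≡
      (if v == s then weight H v * (if adj H v (head r) then restrict (isStWalk H (head r) t) (cost H) r else 0) else 0)
    restrict-cons H s t v (w ∷ ws) rewrite ==-refl w =
      guards-* (vert H v) (adj H v w) (isWalk H (w ∷ ws)) (v == s) (last (w ∷ ws) == t) (α H v) (cost H (w ∷ ws))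

    restrict-by-head : ∀ {n k} (H : WGraph n) (s w t : Fin n) (r : Vec (Fin n) (suc k)) →
      (if head r == w then (if adj H s (head r) then restrict (isStWalk H (head r) t) (cost H) r else 0) else 0)
      ≡ (if adj H s w then restrict (isStWalk H w t) (cost H) r else 0)
    restrict-by-head H s w t r with head r ≟ w
    ... | yes refl rewrite ==-refl (head r) = refl
    ... | no _ with adj H s w | isWalk H r
    ... | false | _ = refl
    ... | true | false = refl
    ... | true | true = refl

  module _ {n : ℕ} (H : WGraph n) where
    walkCount : ℕ → Fin n → Fin n → ℕ
    walkCount k s t = listSum (restrict (isStWalk H s t) (cost H)) (vecs n (suc k))

    -- Enumerating vertex sequences by their first vertex gives the recursion of W.
    opaque
      walkCount≡W : ∀ k s t → walkCount k s t ≡ W (adj H) (weight H) k s t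
      walkCount≡W zero s t = begin
        listSum (restrict (isStWalk H s t) (cost H)) (vecs n 1)
          ≡⟨ listSum-concatMap _ (λ v → map (v ∷_) (vecs n 0)) (allFin n) ⟩
        listSum (λ v → restrict (isStWalk H s t) (cost H) (v ∷ []) + 0) (allFin n)
          ≡⟨ listSum-cong (allFin n) (λ v → trans (NP.+-identityʳ _) (restrict-singleton H s t v)) ⟩
        listSum (λ v → if v == s then (if s == t then weight H s else 0) else 0) (allFin n)
          ≡⟨ listSum-allFin {n} _ ⟩
        ∑ (λ v → if v == s then (if s == t then weight H s else 0) else 0)
          ≡⟨ ∑-δ s (λ _ → if s == t then weight H s else 0) ⟩
        (if s == t then weight H s else 0) ∎
      walkCount≡W (suc k) s t = begin
        listSum (restrict (isStWalk H s t) (cost H)) (vecs n (suc (suc k)))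
          ≡⟨ listSum-concatMap _ (λ v → map (v ∷_) rest) (allFin n) ⟩
        listSum (λ v → listSum (restrict (isStWalk H s t) (cost H)) (map (v ∷_) rest)) (allFin n)
          ≡⟨ listSum-cong (allFin n) first-vertex ⟩
        listSum (λ v → if v == s then weight H v * listSum (tail v) rest else 0) (allFin n)
          ≡⟨ trans (listSum-allFin {n} _) (∑-δ s (λ v → weight H v * listSum (tail v) rest)) ⟩
        weight H s * listSum (tail s) rest
          ≡⟨ cong (weight H s *_) (listSum-group head (tail s) rest) ⟩
        weight H s * ∑ (λ w → listSum (λ r → if head r == w then tail s r else 0) rest)
          ≡⟨ cong (weight H s *_) (sum-cong-≗ second-vertex) ⟩
        W (adj H) (weight H) (suc k) s t ∎
        where
        rest : List (Vec (Fin n) (suc k))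
        rest = vecs n (suc k)
        tail : Fin n → Vec (Fin n) (suc k) → ℕ
        tail u r = if adj H u (head r) then restrict (isStWalk H (head r) t) (cost H) r else 0
        first-vertex : ∀ v → listSum (restrict (isStWalk H s t) (cost H)) (map (v ∷_) rest)
                             ≡ (if v == s then weight H v * listSum (tail v) rest else 0)
        first-vertex v = begin
          listSum (restrict (isStWalk H s t) (cost H)) (map (v ∷_) rest)
            ≡⟨ listSum-map _ (v ∷_) rest ⟩
          listSum (λ r → restrict (isStWalk H s t) (cost H) (v ∷ r)) rest
            ≡⟨ listSum-cong rest (restrict-cons H s t v) ⟩
          listSum (λ r → if v == s then weight H v * tail v r else 0) rest
            ≡⟨ listSum-guard (v == s) _ rest ⟩
          (if v == s then listSum (λ r → weight H v * tail v r) rest else 0)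
            ≡⟨ cong (λ z → if v == s then z else 0) (sym (*-distribˡ-listSum (weight H v) _ rest)) ⟩
          (if v == s then weight H v * listSum (tail v) rest else 0) ∎
        second-vertex : ∀ w → listSum (λ r → if head r == w then tail s r else 0) rest
                              ≡ (if adj H s w then W (adj H) (weight H) k w t else 0)
        second-vertex w = begin
          listSum (λ r → if head r == w then tail s r else 0) rest
            ≡⟨ listSum-cong rest (restrict-by-head H s w t) ⟩
          listSum (λ r → if adj H s w then restrict (isStWalk H w t) (cost H) r else 0) rest
            ≡⟨ listSum-guard (adj H s w) _ rest ⟩
          (if adj H s w then walkCount k w t else 0)
            ≡⟨ cong (λ z → if adj H s w then z else 0) (walkCount≡W k w t) ⟩
          (if adj H s w then W (adj H) (weight H) k w t else 0) ∎

    opaque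
      walkCost≡W : ∀ k s t → listSum (cost H) (walksK H k s t) ≡ W (adj H) (weight H) k s t
      walkCost≡W k s t = trans (listSum-filt (cost H) (isStWalk H s t) (vecs n (suc k))) (walkCount≡W k s t)

    opaque
      σ≡W : ∀ s t → σ H s t ≡ W (adj H) (weight H) (dist H s t) s t
      σ≡W s t = walkCost≡W (dist H s t) s t

  avoid : ∀ {n} → WGraph n → Fin n → WGraph n
  avoid H v = record { vert = λ x → vert H x ∧ not (x == v) ; adj = adj H ; α = α H ; β = β H }

  opaque
    isWalk-avoid : ∀ {n k} (H : WGraph n) (v : Fin n) (w : Vec (Fin n) (suc k)) →
      isWalk (avoid H v) w ≡ isWalk H w ∧ not (contains v w)
    isWalk-avoid H v (x ∷ []) rewrite ==-sym x v with vert H x | v == x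
    ... | true | true = refl
    ... | true | false = refl
    ... | false | _ = refl
    isWalk-avoid H v (x ∷ y ∷ ys) rewrite isWalk-avoid H v (y ∷ ys) | ==-sym x v
      with vert H x | v == x | adj H x y | isWalk H (y ∷ ys) | contains v (y ∷ ys)
    ... | false | _ | _ | _ | _ = refl
    ... | true | true | _ | _ | _ = sym (∧-false _)
      where ∧-false : ∀ b → (b ∧ false) ≡ false
            ∧-false true = refl
            ∧-false false = refl
    ... | true | false | false | _ | _ = refl
    ... | true | false | true | false | _ = refl
    ... | true | false | true | true | _ = refl

  private
    through+avoiding : ∀ (a c h : Bool) (x : ℕ) →
      (if a ∧ h then (if c then x else 0) else 0) + (if (a ∧ not c) ∧ h then x else 0) ≡ (if a ∧ h then x else 0)
    through+avoiding false c h x = refl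
    through+avoiding true true true x = NP.+-identityʳ x
    through+avoiding true true false x = refl
    through+avoiding true false true x = refl
    through+avoiding true false false x = refl

  module _ {n : ℕ} (H : WGraph n) (v : Fin n) where
    -- Every st-walk either passes through v or is a walk of H − v.
    opaque
      walks-through+avoiding : ∀ k s t →
        listSum (cost H) (filt (contains v) (walksK H k s t)) + listSum (cost H) (walksK (avoid H v) k s t)
        ≡ listSum (cost H) (walksK H k s t)
      walks-through+avoiding k s t = begin
        listSum (cost H) (filt (contains v) (walksK H k s t)) + listSum (cost H) (walksK (avoid H v) k s t)
          ≡⟨ cong₂ _+_ (trans (listSum-filt (cost H) (contains v) (walksK H k s t)) (listSum-filt _ (isStWalk H s t) seqs))
                       (listSum-filt (cost H) (isStWalk (avoid H v) s t) seqs) ⟩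
        listSum (restrict (isStWalk H s t) (restrict (contains v) (cost H))) seqs
          + listSum (restrict (isStWalk (avoid H v) s t) (cost H)) seqs
          ≡⟨ sym (listSum-+ _ _ seqs) ⟩
        listSum (λ w → restrict (isStWalk H s t) (restrict (contains v) (cost H)) w
                       + restrict (isStWalk (avoid H v) s t) (cost H) w) seqs
          ≡⟨ listSum-cong seqs pointwise ⟩
        listSum (restrict (isStWalk H s t) (cost H)) seqs
          ≡⟨ sym (listSum-filt (cost H) (isStWalk H s t) seqs) ⟩
        listSum (cost H) (walksK H k s t) ∎
        where
        seqs : List (Vec (Fin n) (suc k))
        seqs = vecs n (suc k)
        pointwise : ∀ (w : Vec (Fin n) (suc k)) →
          restrict (isStWalk H s t) (restrict (contains v) (cost H)) w + restrict (isStWalk (avoid H v) s t) (cost H) w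
          ≡ restrict (isStWalk H s t) (cost H) w
        pointwise w rewrite isWalk-avoid H v w =
          through+avoiding (isWalk H w) (contains v w) ((head w == s) ∧ (last w == t)) (cost H w)

    opaque
      σv+avoiding≡σ : ∀ s t → σv H s t v + W (adj H) (weight (avoid H v)) (dist H s t) s t ≡ σ H s t
      σv+avoiding≡σ s t = trans (cong (σv H s t v +_) (sym avoiding))
                                (walks-through+avoiding (dist H s t) s t)
        where
        same-cost : ∀ {k} (w : Vec (Fin n) k) → cost H w ≡ cost (avoid H v) w
        same-cost [] = refl
        same-cost (x ∷ w) = cong (α H x *_) (same-cost w)
        avoiding : listSum (cost H) (walksK (avoid H v) (dist H s t) s t) ≡ W (adj H) (weight (avoid H v)) (dist H s t) s t
        avoiding = trans (listSum-cong (walksK (avoid H v) (dist H s t) s t) same-cost)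
                         (walkCost≡W (avoid H v) (dist H s t) s t)

module WalkSumProperties where

  open NatSums
  open FinEquality
  open WalkSums
  open import Data.Bool using (Bool; true; false; if_then_else_)
  open import Data.Empty using (⊥-elim)
  open import Data.Nat as ℕ using (ℕ; zero; suc; _*_; _≤_)
  import Data.Nat.Properties as NP
  open import Data.Fin using (Fin; _≟_)
  open import Data.Product using (_×_; _,_; ∃)
  open import Data.Sum using (inj₁; inj₂)
  open import Relation.Nullary using (yes; no; ¬_)
  open import Relation.Binary.PropositionalEquality

  opaque
    *≢0 : ∀ {a b} → ¬ a ≡ 0 → ¬ b ≡ 0 → ¬ a * b ≡ 0
    *≢0 {a} a≢0 b≢0 e with NP.m*n≡0⇒m≡0∨n≡0 a e
    ... | inj₁ a≡0 = a≢0 a≡0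
    ... | inj₂ b≡0 = b≢0 b≡0

    *≢0ˡ : ∀ {a b} → ¬ a * b ≡ 0 → ¬ a ≡ 0
    *≢0ˡ {a} {b} ab≢0 refl = ab≢0 refl

    *≢0ʳ : ∀ {a b} → ¬ a * b ≡ 0 → ¬ b ≡ 0
    *≢0ʳ {a} {b} ab≢0 refl = ab≢0 (NP.*-zeroʳ a)

    ≢0-≤ : ∀ {a b} → a ≤ b → ¬ a ≡ 0 → ¬ b ≡ 0
    ≢0-≤ a≤b a≢0 refl = a≢0 (NP.n≤0⇒n≡0 a≤b)

    if-≢0 : ∀ (b : Bool) {x : ℕ} → ¬ (if b then x else 0) ≡ 0 → (b ≡ true) × ¬ x ≡ 0
    if-≢0 true x≢0 = refl , x≢0
    if-≢0 false 0≢0 = ⊥-elim (0≢0 refl)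

  module WalkSupport {n : ℕ} (adj : Fin n → Fin n → Bool) where
    opaque
      W-0-inv : ∀ ω s t → ¬ W adj ω 0 s t ≡ 0 → s ≡ t
      W-0-inv ω s t W≢0 with s ≟ t
      ... | yes s≡t = s≡t
      ... | no _ = ⊥-elim (W≢0 refl)

      W-0-eq : ∀ ω s → W adj ω 0 s s ≡ ω s
      W-0-eq ω s rewrite ==-refl s = refl

      W-step-inv : ∀ ω k s t → ¬ W adj ω (suc k) s t ≡ 0 → ∃ λ w → (adj s w ≡ true) × ¬ W adj ω k w t ≡ 0
      W-step-inv ω k s t W≢0 with ∑-nonzero _ (*≢0ʳ {ω s} W≢0)
      ... | w , term≢0 = w , if-≢0 (adj s w) term≢0

      W-step-first : ∀ ω k s t → ¬ W adj ω (suc k) s t ≡ 0 → ¬ ω s ≡ 0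
      W-step-first ω k s t W≢0 = *≢0ˡ W≢0

      W-step-pos : ∀ ω k s w t → adj s w ≡ true → ¬ ω s ≡ 0 → ¬ W adj ω k w t ≡ 0 → ¬ W adj ω (suc k) s t ≡ 0
      W-step-pos ω k s w t sw ωs≢0 Ww≢0 =
        *≢0 ωs≢0 (≢0-≤ (∑-≥ (λ u → if adj s u then W adj ω k u t else 0) w) (term≢0 (adj s w) sw))
        where term≢0 : ∀ b → b ≡ true → ¬ (if b then W adj ω k w t else 0) ≡ 0
              term≢0 .true refl = Ww≢0

      W-support : ∀ ω ω' → (∀ x → ¬ ω x ≡ 0 → ¬ ω' x ≡ 0) → ∀ k s t → ¬ W adj ω k s t ≡ 0 → ¬ W adj ω' k s t ≡ 0
      W-support ω ω' supp zero s t W≢0 with W-0-inv ω s t W≢0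
      ... | refl rewrite W-0-eq ω s | W-0-eq ω' s = supp s W≢0
      W-support ω ω' supp (suc k) s t W≢0 with W-step-inv ω k s t W≢0
      ... | w , sw , Ww≢0 = W-step-pos ω' k s w t sw (supp s (W-step-first ω k s t W≢0)) (W-support ω ω' supp k w t Ww≢0)

  opaque
    if-* : ∀ (b : Bool) x c → (if b then x else 0) * c ≡ (if b then x * c else 0)
    if-* true x c = refl
    if-* false x c = refl

    if-if : ∀ (b b' : Bool) (x : ℕ) → (if b then (if b' then x else 0) else 0) ≡ (if b' then (if b then x else 0) else 0)
    if-if true b' x = refl
    if-if false true x = refl
    if-if false false x = refl

  -- Walk sums can equally be computed by the last-step recursion, hence are symmetric
  -- in s and t when the adjacency relation is symmetric.
  module WalkReversal {n : ℕ} (adj : Fin n → Fin n → Bool) where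
    open ≡-Reasoning

    opaque
      W-last : ∀ ω k s t → W adj ω (suc k) s t ≡ ∑ (λ y → if adj y t then W adj ω k s y else 0) * ω t
      W-last ω zero s t = begin
          ω s * ∑ (λ w → if adj s w then (if w == t then ω w else 0) else 0)
        ≡⟨ cong (ω s *_) (trans (sum-cong-≗ {n} (λ w → if-if (adj s w) (w == t) (ω w))) (∑-δ t (λ w → if adj s w then ω w else 0))) ⟩
          ω s * (if adj s t then ω t else 0)
        ≡⟨ by-cases (adj s t) ⟩
          (if adj s t then ω s else 0) * ω t
        ≡⟨ cong (_* ω t) (sym (trans (sum-cong-≗ {n} (λ y → trans (cong (λ b → if adj y t then (if b then ω s else 0) else 0) (==-sym s y)) (if-if (adj y t) (y == s) (ω s)))) (∑-δ s (λ y → if adj y t then ω s else 0)))) ⟩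
          ∑ (λ y → if adj y t then W adj ω zero s y else 0) * ω t
        ∎ where by-cases : ∀ b → ω s * (if b then ω t else 0) ≡ (if b then ω s else 0) * ω t
                by-cases true = refl
                by-cases false = NP.*-zeroʳ (ω s)
      W-last ω (suc k) s t = begin
          ω s * ∑ (λ w → if adj s w then W adj ω (suc k) w t else 0)
        ≡⟨ cong (ω s *_) (sum-cong-≗ {n} (λ w → trans (cong (λ z → if adj s w then z else 0) (W-last ω k w t))
              (trans (cong (λ z → if adj s w then z else 0) (*-distribʳ-sum {n} (ω t) _)) (sym (∑-guard {n} (adj s w) _))))) ⟩
          ω s * ∑ (λ w → ∑ (λ y → if adj s w then (if adj y t then W adj ω k w y else 0) * ω t else 0))
        ≡⟨ cong (ω s *_) (∑-comm {n} {n} _) ⟩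
          ω s * ∑ (λ y → ∑ (λ w → if adj s w then (if adj y t then W adj ω k w y else 0) * ω t else 0))
        ≡⟨ *-distribˡ-sum {n} (ω s) _ ⟩
          ∑ (λ y → ω s * ∑ (λ w → if adj s w then (if adj y t then W adj ω k w y else 0) * ω t else 0))
        ≡⟨ sum-cong-≗ {n} (λ y → pointwise y (adj y t)) ⟩
          ∑ (λ y → (if adj y t then W adj ω (suc k) s y else 0) * ω t)
        ≡⟨ sym (*-distribʳ-sum {n} (ω t) _) ⟩
          ∑ (λ y → if adj y t then W adj ω (suc k) s y else 0) * ω t
        ∎ where
          pointwise : ∀ y b → ω s * ∑ (λ w → if adj s w then (if b then W adj ω k w y else 0) * ω t else 0)
                       ≡ (if b then W adj ω (suc k) s y else 0) * ω t
          pointwise y true = trans (cong (ω s *_) (sym (trans (*-distribʳ-sum {n} (ω t) _) (sum-cong-≗ {n} (λ w → if-* (adj s w) _ (ω t))))))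
                            (sym (NP.*-assoc (ω s) _ (ω t)))
          pointwise y false = trans (cong (ω s *_) (trans (sum-cong-≗ {n} (λ w → zero-cases (adj s w))) (sum-replicate-zero n))) (NP.*-zeroʳ (ω s))
            where zero-cases : ∀ b → (if b then 0 * ω t else 0) ≡ 0
                  zero-cases true = refl
                  zero-cases false = refl

    opaque
      W-sym : (∀ u w → adj u w ≡ adj w u) → ∀ ω k s t → W adj ω k s t ≡ W adj ω k t s
      W-sym adj-sym ω zero s t with s ≟ t
      ... | yes refl rewrite ==-refl s = refl
      ... | no ne rewrite ==-≢ (λ e → ne (sym e)) = refl
      W-sym adj-sym ω (suc k) s t = begin
          W adj ω (suc k) s t
        ≡⟨ W-last ω k s t ⟩
          ∑ (λ y → if adj y t then W adj ω k s y else 0) * ω t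
        ≡⟨ cong (_* ω t) (sum-cong-≗ {n} (λ y → cong₂ (λ b z → if b then z else 0) (adj-sym y t) (W-sym adj-sym ω k s y))) ⟩
          ∑ (λ y → if adj t y then W adj ω k y s else 0) * ω t
        ≡⟨ NP.*-comm _ (ω t) ⟩
          W adj ω (suc k) t s
        ∎

module Distance where

  open NatSums
  open WalkSums
  open WalkSumProperties
  open import Data.Empty using (⊥-elim)
  open import Data.Nat as ℕ using (ℕ; zero; suc; _+_; _≤_; _<_; z≤n; s≤s)
  import Data.Nat.Properties as NP
  open import Data.Fin using (Fin)
  open import Data.Vec using (Vec; []; _∷_)
  open import Data.List using ([]; _∷_; applyUpTo)
  open import Data.Sum using (inj₁; inj₂)
  open import Function using (_∘_)
  open import Relation.Nullary using (¬_)
  open import Relation.Binary.PropositionalEquality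

  opaque
    cost-pos : ∀ {n k} (H : WGraph n) → (∀ x → ¬ α H x ≡ 0) → (w : Vec (Fin n) k) → ¬ cost H w ≡ 0
    cost-pos H pos [] ()
    cost-pos H pos (x ∷ w) e with NP.m*n≡0⇒m≡0∨n≡0 (α H x) e
    ... | inj₁ αx≡0 = pos x αx≡0
    ... | inj₂ cost≡0 = cost-pos H pos w cost≡0

  -- For positive weights, st-walks with k edges exist iff W ≠ 0; hence dist H s t is the
  -- least k ≤ n with W ≠ 0.
  module _ {n : ℕ} (H : WGraph n) (pos : ∀ x → ¬ α H x ≡ 0) (s t : Fin n) where
    private
      Wst : ℕ → ℕ
      Wst k = W (adj H) (weight H) k s t

    opaque
      walks-nonempty : ∀ k → ¬ Wst k ≡ 0 → ¬ walksK H k s t ≡ []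
      walks-nonempty k W≢0 e = W≢0 (trans (sym (walkCost≡W H k s t)) (cong (listSum (cost H)) e))

      walks-empty : ∀ k → Wst k ≡ 0 → ∀ {x xs} → ¬ walksK H k s t ≡ x ∷ xs
      walks-empty k W≡0 {x} e = cost-pos H pos x (NP.m+n≡0⇒m≡0 (cost H x)
        (trans (cong (listSum (cost H)) (sym e)) (trans (walkCost≡W H k s t) W≡0)))

      searchDist-finds : ∀ m (f : ℕ → ℕ) i → i < m → ¬ Wst (f i) ≡ 0 → (∀ j → j < i → Wst (f j) ≡ 0) →
                         searchDist H s t (applyUpTo f m) ≡ f i
      searchDist-finds (suc m) f zero _ W≢0 _ with walksK H (f zero) s t in eq
      ... | [] = ⊥-elim (walks-nonempty (f zero) W≢0 eq)
      ... | _ ∷ _ = refl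
      searchDist-finds (suc m) f (suc i) (s≤s i<m) W≢0 below with walksK H (f zero) s t in eq
      ... | [] = searchDist-finds m (f ∘ suc) i i<m W≢0 (λ j j<i → below (suc j) (s≤s j<i))
      ... | _ ∷ _ = ⊥-elim (walks-empty (f zero) (below zero (s≤s z≤n)) eq)

      dist-char : ∀ i → i ≤ n → ¬ Wst i ≡ 0 → (∀ j → j < i → Wst j ≡ 0) → dist H s t ≡ i
      dist-char i i≤n W≢0 below = searchDist-finds (suc n) (λ x → x) i (s≤s i≤n) W≢0 below

  module Symmetry {n : ℕ} (H : WGraph n) (pos : ∀ x → ¬ α H x ≡ 0) (adj-sym : ∀ u w → adj H u w ≡ adj H w u) where
    open WalkReversal (adj H)

    opaque
      no-walks : ∀ {k} s t → walksK H k s t ≡ [] → W (adj H) (weight H) k t s ≡ 0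
      no-walks {k} s t e = trans (sym (W-sym adj-sym (weight H) k s t))
                                 (trans (sym (walkCost≡W H k s t)) (cong (listSum (cost H)) e))

      searchDist-sym : ∀ s t ks → searchDist H s t ks ≡ searchDist H t s ks
      searchDist-sym s t [] = refl
      searchDist-sym s t (k ∷ ks) with walksK H k s t in e1 | walksK H k t s in e2
      ... | [] | [] = searchDist-sym s t ks
      ... | _ ∷ _ | _ ∷ _ = refl
      ... | [] | _ ∷ _ = ⊥-elim (walks-empty H pos t s k (no-walks s t e1) e2)
      ... | _ ∷ _ | [] = ⊥-elim (walks-empty H pos s t k (no-walks t s e2) e1)

      dist-sym : ∀ s t → dist H s t ≡ dist H t s
      dist-sym s t = searchDist-sym s t _

      σ-sym : ∀ s t → σ H s t ≡ σ H t s
      σ-sym s t = trans (σ≡W H s t) (trans (cong (λ k → W (adj H) (weight H) k s t) (dist-sym s t))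
                    (trans (W-sym adj-sym (weight H) (dist H t s) s t) (sym (σ≡W H t s))))

      σv-sym : ∀ v s t → σv H s t v ≡ σv H t s v
      σv-sym v s t = NP.+-cancelʳ-≡ _ _ _ (trans (σv+avoiding≡σ H v s t) (trans (σ-sym s t) (sym (trans
                       (cong (σv H t s v +_) avoiding-sym) (σv+avoiding≡σ H v t s)))))
        where
        avoiding-sym : W (adj H) (weight (avoid H v)) (dist H s t) s t ≡ W (adj H) (weight (avoid H v)) (dist H t s) t s
        avoiding-sym = trans (W-sym adj-sym (weight (avoid H v)) (dist H s t) s t)
                             (cong (λ k → W (adj H) (weight (avoid H v)) k t s) (dist-sym s t))

module DistanceLayers where

  open NatSums
  open WalkSums
  open WalkSumProperties
  open Distance
  open import Data.Bool using (Bool; true; false; _∧_; if_then_else_; T)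
  open import Data.Bool.Properties using (T-≡; T-∧)
  open import Data.Empty using (⊥-elim)
  open import Data.Nat as ℕ using (ℕ; zero; suc; _+_; _*_; _∸_; _≤_; _<_; z≤n; s≤s)
  import Data.Nat.Properties as NP
  open import Data.Fin using (Fin; toℕ)
  import Data.Fin.Properties as FP
  open import Data.Vec using (Vec; []; _∷_; head; last)
  open import Data.Product using (_×_; _,_; proj₁; proj₂; ∃)
  open import Data.Sum using (inj₁; inj₂; _⊎_)
  open import Function using (Equivalence)
  open import Relation.Nullary using (yes; no; ¬_)
  open import Relation.Nullary.Decidable using (⌊_⌋)
  open import Relation.Binary using (tri<; tri≈; tri>)
  open import Relation.Binary.PropositionalEquality

  open Equivalence using (to; from)

  eqn : ℕ → ℕ → Bool
  eqn a b = ⌊ a ℕ.≟ b ⌋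

  opaque
    eqn-t : ∀ {a b} → a ≡ b → eqn a b ≡ true
    eqn-t {a} {b} a≡b with a ℕ.≟ b
    ... | yes _ = refl
    ... | no a≢b = ⊥-elim (a≢b a≡b)

    eqn-f : ∀ {a b} → ¬ a ≡ b → eqn a b ≡ false
    eqn-f {a} {b} a≢b with a ℕ.≟ b
    ... | yes a≡b = ⊥-elim (a≢b a≡b)
    ... | no _ = refl

  opaque
    eqn-suc : ∀ l m → eqn (suc l) (suc m) ≡ eqn l m
    eqn-suc l m with l ℕ.≟ m
    ... | yes e = eqn-t (cong suc e)
    ... | no ne = eqn-f (λ e → ne (NP.suc-injective e))

    eqn-subst : ∀ l m (X : ℕ → ℕ) → (if eqn l m then X m else 0) ≡ (if eqn l m then X l else 0)
    eqn-subst l m X with l ℕ.≟ m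
    ... | yes e = cong X (sym e)
    ... | no ne = refl

    eqn-ne : ∀ l m X → ¬ l ≡ m → (if eqn l m then X else 0) ≡ 0
    eqn-ne l m X ne rewrite eqn-f ne = refl

    eqn-cong-* : ∀ l m X Y K1 K2 → (l ≡ m → X * K1 ≡ Y * K2) → (if eqn l m then X else 0) * K1 ≡ (if eqn l m then Y else 0) * K2
    eqn-cong-* l m X Y K1 K2 f with l ℕ.≟ m
    ... | yes e = f e
    ... | no _ = refl

    eqn-affine : ∀ l m X Y S Z → (l ≡ m → X ≡ Y + S * Z) → (if eqn l m then X else 0) ≡ (if eqn l m then Y else 0) + S * (if eqn l m then Z else 0)
    eqn-affine l m X Y S Z f with l ℕ.≟ m
    ... | yes e = f e
    ... | no _ = sym (NP.*-zeroʳ S)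

    eqn-cong : ∀ l m X Y → (l ≡ m → X ≡ Y) → (if eqn l m then X else 0) ≡ (if eqn l m then Y else 0)
    eqn-cong l m X Y f with l ℕ.≟ m
    ... | yes e = f e
    ... | no _ = refl

  opaque
    least : (g : ℕ → ℕ) → ∀ k → ¬ g k ≡ 0 → ∃ λ i → i ≤ k × ¬ g i ≡ 0 × (∀ j → j < i → g j ≡ 0)
    least g k gk≢0 with search k
      where
      search : ∀ k → (∀ j → j ≤ k → g j ≡ 0) ⊎ (∃ λ i → i ≤ k × ¬ g i ≡ 0 × (∀ j → j < i → g j ≡ 0))
      search zero with g zero ℕ.≟ 0
      ... | yes g0≡0 = inj₁ (λ { zero _ → g0≡0 })
      ... | no g0≢0 = inj₂ (zero , z≤n , g0≢0 , λ j ())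
      search (suc k) with search k
      ... | inj₂ (i , i≤k , gi≢0 , below) = inj₂ (i , NP.m≤n⇒m≤1+n i≤k , gi≢0 , below)
      ... | inj₁ zeros with g (suc k) ℕ.≟ 0
      ...   | no gk≢0 = inj₂ (suc k , NP.≤-refl , gk≢0 , λ j j<sk → zeros j (NP.≤-pred j<sk))
      ...   | yes gk≡0 = inj₁ zeros′
        where zeros′ : ∀ j → j ≤ suc k → g j ≡ 0
              zeros′ j j≤sk with NP.m≤n⇒m<n∨m≡n j≤sk
              ... | inj₁ j<sk = zeros j (NP.≤-pred j<sk)
              ... | inj₂ refl = gk≡0
    ... | inj₁ zeros = ⊥-elim (gk≢0 (zeros k NP.≤-refl))
    ... | inj₂ found = found

  opaque
    weight-vert : ∀ {n} (H : WGraph n) x → vert H x ≡ true → weight H x ≡ α H x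
    weight-vert H x x∈H rewrite x∈H = refl

    walk⇒W≢0 : ∀ {n k} (H : WGraph n) → (∀ x → ¬ α H x ≡ 0) → (w : Vec (Fin n) (suc k)) → T (isWalk H w) →
      ¬ W (adj H) (weight H) k (head w) (last w) ≡ 0
    walk⇒W≢0 H pos (x ∷ []) x∈H e =
      pos x (trans (sym (weight-vert H x (to T-≡ x∈H))) (trans (sym (WalkSupport.W-0-eq (adj H) (weight H) x)) e))
    walk⇒W≢0 {k = suc k} H pos (x ∷ y ∷ ys) walk with to T-∧ walk
    ... | x∈H , rest with to (T-∧ {adj H x y}) rest
    ... | xy , ys-walk =
      WalkSupport.W-step-pos (adj H) (weight H) k x y (last (y ∷ ys)) (to T-≡ xy)
        (λ e → pos x (trans (sym (weight-vert H x (to T-≡ x∈H))) e)) (walk⇒W≢0 H pos (y ∷ ys) ys-walk)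

    restrict-to-layer : ∀ (l m X : ℕ) → (m < l → X ≡ 0) → m ≤ l → X ≡ (if eqn l m then X else 0)
    restrict-to-layer l m X vanishes m≤l with l ℕ.≟ m
    ... | yes _ = refl
    ... | no l≢m = vanishes (NP.≤∧≢⇒< m≤l (λ m≡l → l≢m (sym m≡l)))

  -- Shortest walks descend one layer per step, so W restricted to
  -- distance-many steps satisfies a layered recursion (W-layered).
  module Layers {n : ℕ} (G : WGraph n) (allv : ∀ v → vert G v ≡ true)
                (conn : Connected G) (pos : ∀ x → ¬ α G x ≡ 0) (t : Fin n) where
    open WalkSupport (adj G) public

    ωG : Fin n → ℕ
    ωG = weight G

    opaque
      ωG-eq : ∀ x → ωG x ≡ α G x
      ωG-eq x = weight-vert G x (allv x)

      ωG-pos : ∀ x → ¬ ωG x ≡ 0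
      ωG-pos x e = pos x (trans (sym (ωG-eq x)) e)

    Wt : (Fin n → ℕ) → ℕ → Fin n → ℕ
    Wt ω k s = W (adj G) ω k s t

    IsDist : ℕ → Fin n → Set
    IsDist j x = ¬ Wt ωG j x ≡ 0 × (∀ i → i < j → Wt ωG i x ≡ 0)

    opaque
      IsDist-exists : ∀ s → ∃ λ K → IsDist K s
      IsDist-exists s with conn s t (from T-≡ (allv s)) (from T-≡ (allv t))
      ... | k , w , iw , refl , refl with least (λ j → Wt ωG j (head w)) k (walk⇒W≢0 G pos w iw)
      ... | i , _ , Wi≢0 , below = i , Wi≢0 , below

      IsDist-unique : ∀ i j x → IsDist i x → IsDist j x → i ≡ j
      IsDist-unique i j x (Wi≢0 , below-i) (Wj≢0 , below-j) with NP.<-cmp i j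
      ... | tri< i<j _ _ = ⊥-elim (Wi≢0 (below-j i i<j))
      ... | tri≈ _ i≡j _ = i≡j
      ... | tri> _ _ j<i = ⊥-elim (Wj≢0 (below-i j j<i))

      IsDist-pred : ∀ j x → IsDist (suc j) x → ∃ λ y → IsDist j y
      IsDist-pred j x (W≢0 , below) with W-step-inv ωG j x t W≢0
      ... | y , xy , Wy≢0 = y , Wy≢0 , λ i i<j → vanishes i i<j
        where vanishes : ∀ i → i < j → Wt ωG i y ≡ 0
              vanishes i i<j with Wt ωG i y ℕ.≟ 0
              ... | yes W≡0 = W≡0
              ... | no W≢0′ = ⊥-elim (W-step-pos ωG i x y t xy (ωG-pos x) W≢0′ (below (suc i) (s≤s i<j)))

      IsDist-below : ∀ K s → IsDist K s → ∀ m d → d + m ≡ K → ∃ λ x → IsDist d x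
      IsDist-below K s dK zero d e rewrite NP.+-identityʳ d | e = s , dK
      IsDist-below K s dK (suc m) d e with IsDist-below K s dK m (suc d) (trans (sym (NP.+-suc d m)) e)
      ... | x , dx = IsDist-pred d x dx

      layer-witness : ∀ K s → IsDist K s → (i : Fin (suc K)) → ∃ λ x → IsDist (toℕ i) x
      layer-witness K s dK i = IsDist-below K s dK (K ∸ toℕ i) (toℕ i) (NP.m+[n∸m]≡n (FP.toℕ≤pred[n] i))

      -- distinct layers have distinct vertices, so by pigeonhole distances are below n
      IsDist-<n : ∀ K s → IsDist K s → K < n
      IsDist-<n K s dK with K ℕ.<? n
      ... | yes K<n = K<n
      ... | no K≮n with FP.pigeonhole (s≤s (NP.≮⇒≥ K≮n)) (λ i → proj₁ (layer-witness K s dK i))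
      ... | i , j , i<j , same = ⊥-elim (NP.<-irrefl (IsDist-unique (toℕ i) (toℕ j) _
              (proj₂ (layer-witness K s dK i)) (subst (IsDist (toℕ j)) (sym same) (proj₂ (layer-witness K s dK j)))) i<j)

    opaque
      ℓ : Fin n → ℕ
      ℓ s = dist G s t

    opaque
      unfolding ℓ
      ℓ-def : ∀ s → ℓ s ≡ dist G s t
      ℓ-def s = refl

    opaque
      ℓ-IsDist : ∀ s → IsDist (ℓ s) s
      ℓ-IsDist s with IsDist-exists s
      ... | K , dK@(W≢0 , below) =
        subst (λ k → IsDist k s) (sym (trans (ℓ-def s) (dist-char G pos s t K (NP.<⇒≤ (IsDist-<n K s dK)) W≢0 below))) dK

      ℓ-ne : ∀ s → ¬ Wt ωG (ℓ s) s ≡ 0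
      ℓ-ne s = proj₁ (ℓ-IsDist s)

      ℓ-<n : ∀ s → ℓ s < n
      ℓ-<n s = IsDist-<n (ℓ s) s (ℓ-IsDist s)

      ℓ-min : ∀ k s → ¬ Wt ωG k s ≡ 0 → ℓ s ≤ k
      ℓ-min k s W≢0 with ℓ s ℕ.≤? k
      ... | yes ℓ≤k = ℓ≤k
      ... | no ℓ≰k = ⊥-elim (W≢0 (proj₂ (ℓ-IsDist s) k (NP.≰⇒> ℓ≰k)))

      ℓ-minω : ∀ ω k s → ¬ Wt ω k s ≡ 0 → ℓ s ≤ k
      ℓ-minω ω k s W≢0 = ℓ-min k s (W-support ω ωG (λ x _ → ωG-pos x) k s t W≢0)

      zero-below : ∀ ω k x → k < ℓ x → Wt ω k x ≡ 0
      zero-below ω k x k<ℓ with Wt ω k x ℕ.≟ 0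
      ... | yes W≡0 = W≡0
      ... | no W≢0 = ⊥-elim (NP.<⇒≱ k<ℓ (ℓ-minω ω k x W≢0))

      ℓ-adj : ∀ x y → adj G x y ≡ true → ℓ x ≤ suc (ℓ y)
      ℓ-adj x y xy = ℓ-min (suc (ℓ y)) x (W-step-pos ωG (ℓ y) x y t xy (ωG-pos x) (ℓ-ne y))

      ℓ-0 : ∀ s → ℓ s ≡ 0 → s ≡ t
      ℓ-0 s e = W-0-inv ωG s t (subst (λ k → ¬ Wt ωG k s ≡ 0) e (ℓ-ne s))

      ℓ-pred : ∀ x m → ℓ x ≡ suc m → ∃ λ y → adj G x y ≡ true × ℓ y ≡ m
      ℓ-pred x m e with W-step-inv ωG m x t (subst (λ k → ¬ Wt ωG k x ≡ 0) e (ℓ-ne x))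
      ... | y , xy , Wy≢0 = y , xy , NP.≤-antisym (ℓ-min m y Wy≢0) (NP.≤-pred (subst (_≤ suc (ℓ y)) e (ℓ-adj x y xy)))

      W-layered : ∀ ω x m → ℓ x ≡ suc m →
        Wt ω (suc m) x ≡ ω x * ∑ (λ w → if adj G x w then (if eqn (ℓ w) m then Wt ω m w else 0) else 0)
      W-layered ω x m e = cong (ω x *_) (sum-cong-≗ (λ w → step w (adj G x w) refl))
        where step : ∀ w b → adj G x w ≡ b → (if b then Wt ω m w else 0) ≡ (if b then (if eqn (ℓ w) m then Wt ω m w else 0) else 0)
              step w false _ = refl
              step w true xw = restrict-to-layer (ℓ w) m (Wt ω m w) (zero-below ω m w)
                                 (NP.≤-pred (subst (_≤ suc (ℓ w)) e (ℓ-adj x w xw)))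

module SplitSide where

  open NatSums
  open FinEquality
  open WalkSums
  open WalkSumProperties
  open DistanceLayers
  open import Data.Bool using (Bool; true; false; _∧_; not; if_then_else_)
  open import Data.Empty using (⊥; ⊥-elim)
  open import Data.Nat as ℕ using (ℕ; zero; suc; _+_; _*_; _≤_; _<_)
  import Data.Nat.Properties as NP
  open import Data.Nat.Solver using () renaming (module +-*-Solver to ℕ-Solver)
  open import Data.Fin using (Fin; _≟_)
  open import Data.Product using (_×_; _,_; proj₁; proj₂; ∃)
  open import Relation.Nullary using (yes; no; ¬_)
  open import Relation.Binary.PropositionalEquality

  opaque
    t-f : ∀ {b} → b ≡ true → b ≡ false → ⊥
    t-f refl ()

  -- BP = N(Q) ⊆ P and
  -- BQ = N(P) ⊆ Q are the boundaries, every P–Q edge joins BP and BQ and BP × BQ is complete;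
  -- r ∈ BQ is the vertex that represents Q after contraction.  All shortest walks from Q to t
  -- leave Q through BQ at one common distance ℓ r, so they factor through the boundary
  -- factor Kf, which yields the three facts used for the theorem:
  --   Contraction  – contracting Q onto r (weight Σ_BQ ω) preserves walk sums from P;
  --   cross-ratio  – from Q, W ω₁ / W ω₂ is Kf ω₁ / Kf ω₂ when ω₁ and ω₂ agree on Q;
  --   Affine       – from P, W ω is affine in the total boundary weight Σ_BQ ω.
  module SideOfSplit {n : ℕ} (G : WGraph n) (allv : ∀ v → vert G v ≡ true) (adj-sym : ∀ u w → adj G u w ≡ adj G w u)
            (conn : Connected G) (pos : ∀ x → ¬ α G x ≡ 0) (t : Fin n)
            (P Q BP BQ : Fin n → Bool) (t∈P : P t ≡ true)
            (Q≡¬P : ∀ x → Q x ≡ not (P x))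
            (Q→BP : ∀ u w → adj G u w ≡ true → Q u ≡ true → P w ≡ true → BP w ≡ true)
            (BP⊆P : ∀ x → BP x ≡ true → P x ≡ true)
            (BQ⊆Q : ∀ x → BQ x ≡ true → Q x ≡ true)
            (BP-BQ : ∀ c d → BP c ≡ true → BQ d ≡ true → adj G c d ≡ true)
            (P→BQ : ∀ u w → adj G u w ≡ true → P u ≡ true → Q w ≡ true → BQ w ≡ true)
            (r : Fin n) (r∈BQ : BQ r ≡ true) where
    open Layers G allv conn pos t public

    opaque
      P-Q-disjoint : ∀ x → P x ≡ true → Q x ≡ true → ⊥
      P-Q-disjoint x p q rewrite Q≡¬P x | p = t-f q refl

    opaque
      ¬P⇒Q : ∀ x → P x ≡ false → Q x ≡ true
      ¬P⇒Q x p rewrite Q≡¬P x | p = refl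

    opaque
      Q-ℓ-suc : ∀ u → Q u ≡ true → ∃ λ m → ℓ u ≡ suc m
      Q-ℓ-suc u q with ℓ u in e
      ... | zero = ⊥-elim (P-Q-disjoint t t∈P (subst (λ z → Q z ≡ true) (ℓ-0 u e) q))
      ... | suc m = m , refl

    opaque
      BP-closer-acc : ∀ k u → ℓ u ≤ k → Q u ≡ true → ∃ λ c → BP c ≡ true × ℓ c < ℓ u
      BP-closer-acc k u le q with Q-ℓ-suc u q
      ... | m , e with ℓ-pred u m e
      ... | y , a , ey with P y in py
      ... | true = y , Q→BP u y a q py , subst (λ z → ℓ y < z) (sym e) (subst (λ z → z < suc m) (sym ey) NP.≤-refl)
      ... | false with k
      ...   | zero = ⊥-elim (NP.1+n≰n (NP.≤-trans (NP.≤-reflexive (sym e)) (NP.≤-trans le ℕ.z≤n)))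
      ...   | suc k' with BP-closer-acc k' y (subst (_≤ k') (sym ey) (NP.≤-pred (subst (_≤ suc k') e le))) (¬P⇒Q y py)
      ...     | c , bc , lt = c , bc , NP.<-trans lt (subst (λ z → ℓ y < z) (sym e) (subst (λ z → z < suc m) (sym ey) NP.≤-refl))

    opaque
      BP-closer : ∀ u → Q u ≡ true → ∃ λ c → BP c ≡ true × ℓ c < ℓ u
      BP-closer u = BP-closer-acc (ℓ u) u NP.≤-refl

    opaque
      BQ-closest : ∀ d u → BQ d ≡ true → Q u ≡ true → ℓ d ≤ ℓ u
      BQ-closest d u bd q with BP-closer u q
      ... | c , bc , lt = NP.≤-trans (ℓ-adj d c (trans (adj-sym d c) (BP-BQ c d bc bd))) lt

    opaque
      ℓ-BQ : ∀ u → BQ u ≡ true → ℓ u ≡ ℓ r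
      ℓ-BQ u bu = NP.≤-antisym (BQ-closest u r bu (BQ⊆Q r r∈BQ)) (BQ-closest r u r∈BQ (BQ⊆Q u bu))

    Kf : (Fin n → ℕ) → ℕ
    Kf ω = ∑ (λ y → if BP y then (if eqn (suc (ℓ y)) (ℓ r) then Wt ω (ℓ y) y else 0) else 0)

    opaque
      adj-BQ-P : ∀ u y → BQ u ≡ true → P y ≡ true → adj G u y ≡ BP y
      adj-BQ-P u y bu py with BP y in bpy
      ... | true = trans (adj-sym u y) (BP-BQ y u bpy bu)
      ... | false with adj G u y in a
      ...   | false = refl
      ...   | true = ⊥-elim (t-f (Q→BP u y a (BQ⊆Q u bu) py) bpy)

    -- from a vertex u ∈ BQ every shortest walk steps into BP, so W factors as ω u · Kf ω
    opaque
      W-BQ : ∀ ω u → BQ u ≡ true → Wt ω (ℓ u) u ≡ ω u * Kf ω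
      W-BQ ω u bu with Q-ℓ-suc u (BQ⊆Q u bu)
      ... | m , e = begin
          Wt ω (ℓ u) u
        ≡⟨ cong (λ k → Wt ω k u) e ⟩
          Wt ω (suc m) u
        ≡⟨ W-layered ω u m e ⟩
          ω u * ∑ (λ w → if adj G u w then (if eqn (ℓ w) m then Wt ω m w else 0) else 0)
        ≡⟨ cong (ω u *_) (sum-cong-≗ pointwise) ⟩
          ω u * Kf ω
        ∎ where
          open ≡-Reasoning
          er : ℓ r ≡ suc m
          er = trans (sym (ℓ-BQ u bu)) e
          pointwise : ∀ y → (if adj G u y then (if eqn (ℓ y) m then Wt ω m y else 0) else 0)
                     ≡ (if BP y then (if eqn (suc (ℓ y)) (ℓ r) then Wt ω (ℓ y) y else 0) else 0)
          pointwise y with P y in py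
          ... | true rewrite adj-BQ-P u y bu py | er | eqn-suc (ℓ y) m = cong (λ z → if BP y then z else 0) (eqn-subst (ℓ y) m (λ k → Wt ω k y))
          ... | false with BP y in bpy
          ...   | true = ⊥-elim (t-f (BP⊆P y bpy) py)
          ...   | false with adj G u y
          ...     | false = refl
          ...     | true = eqn-ne (ℓ y) m _ (λ q → NP.1+n≰n (subst (suc m ≤_) q (subst (_≤ ℓ y) er (BQ-closest r y r∈BQ (¬P⇒Q y py)))))

    opaque
      BQ⇒¬P : ∀ x → BQ x ≡ true → P x ≡ false
      BQ⇒¬P x bq with P x in px
      ... | true = ⊥-elim (P-Q-disjoint x px (BQ⊆Q x bq))
      ... | false = refl

    opaque
      adj-P-Q : ∀ x w → P x ≡ true → P w ≡ false → adj G x w ≡ BP x ∧ BQ w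
      adj-P-Q x w px pw with adj G x w in a
      ... | true rewrite Q→BP w x (trans (adj-sym w x) a) (¬P⇒Q w pw) px | P→BQ x w a px (¬P⇒Q w pw) = refl
      ... | false with BP x in bx | BQ w in bw
      ...   | true | true = ⊥-elim (t-f (BP-BQ x w bx bw) a)
      ...   | true | false = refl
      ...   | false | _ = refl

    opaque
      far-side-part : ∀ ω x m → P x ≡ true →
        ∑ (λ w → if P w then 0 else (if adj G x w then (if eqn (ℓ w) m then Wt ω m w else 0) else 0))
        ≡ (if BP x ∧ eqn (ℓ r) m then ∑ (λ w → if BQ w then ω w else 0) * Kf ω else 0)
      far-side-part ω x m px = trans (sum-cong-≗ pointwise) (∑-guard-*ʳ {n} (BP x ∧ eqn (ℓ r) m) _ (Kf ω))
        where
        pointwise : ∀ w → (if P w then 0 else (if adj G x w then (if eqn (ℓ w) m then Wt ω m w else 0) else 0))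
                   ≡ (if BP x ∧ eqn (ℓ r) m then (if BQ w then ω w else 0) * Kf ω else 0)
        pointwise w with P w in pw
        ... | true with BQ w in bw
        ...   | true = ⊥-elim (t-f pw (BQ⇒¬P w bw))
        ...   | false = by-cases (BP x ∧ eqn (ℓ r) m)
          where by-cases : ∀ c → 0 ≡ (if c then 0 * Kf ω else 0)
                by-cases true = refl
                by-cases false = refl
        pointwise w | false rewrite adj-P-Q x w px pw with BP x | BQ w in bw
        ... | false | _ = refl
        ... | true | false = by-cases (eqn (ℓ r) m)
          where by-cases : ∀ c → 0 ≡ (if c then 0 * Kf ω else 0)
                by-cases true = refl
                by-cases false = refl
        ... | true | true rewrite ℓ-BQ w bw = trans (eqn-subst (ℓ r) m (λ k → Wt ω k w))
                (cong (λ z → if eqn (ℓ r) m then z else 0) (trans (cong (λ k → Wt ω k w) (sym (ℓ-BQ w bw))) (W-BQ ω w bw)))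

    module Contraction (ω ω' : Fin n → ℕ) (agree-P : ∀ x → P x ≡ true → ω' x ≡ ω x)
              (vanish-Q : ∀ x → P x ≡ false → ¬ x ≡ r → ω' x ≡ 0)
              (weight-r : ω' r ≡ ∑ (λ d → if BQ d then ω d else 0)) where

      Agrees : Fin n → Set
      Agrees x = Wt ω' (ℓ x) x ≡ Wt ω (ℓ x) x

      opaque
        ω'-BQ-sum : ∑ (λ w → if BQ w then ω' w else 0) ≡ ω' r
        ω'-BQ-sum = trans (sum-cong-≗ pointwise) (∑-δ r (λ _ → ω' r))
          where pointwise : ∀ w → (if BQ w then ω' w else 0) ≡ (if w == r then ω' r else 0)
                pointwise w with w ≟ r
                ... | yes refl rewrite r∈BQ = refl
                ... | no ne with BQ w in bw
                ...   | true = vanish-Q w (BQ⇒¬P w bw) ne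
                ...   | false = refl

      opaque
        Kf-eq : (∀ y → P y ≡ true → suc (ℓ y) ≡ ℓ r → Agrees y) → Kf ω' ≡ Kf ω
        Kf-eq ih = sum-cong-≗ pointwise
          where pointwise : ∀ y → (if BP y then (if eqn (suc (ℓ y)) (ℓ r) then Wt ω' (ℓ y) y else 0) else 0)
                          ≡ (if BP y then (if eqn (suc (ℓ y)) (ℓ r) then Wt ω (ℓ y) y else 0) else 0)
                pointwise y with BP y in by
                ... | false = refl
                ... | true = eqn-cong (suc (ℓ y)) (ℓ r) _ _ (ih y (BP⊆P y by))

      opaque
        contraction-acc : ∀ k x → ℓ x ≤ k → P x ≡ true → Agrees x
        contraction-acc k x le px with ℓ x in e
        ... | zero with ℓ-0 x e
        ...   | refl = trans (W-0-eq ω' t) (trans (agree-P t px) (sym (W-0-eq ω t)))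
        contraction-acc (suc k) x le px | suc m = begin
            Wt ω' (suc m) x
          ≡⟨ W-layered ω' x m e ⟩
            ω' x * ∑ (F ω')
          ≡⟨ cong₂ _*_ (agree-P x px) (∑-split {n} P (F ω')) ⟩
            ω x * (∑ (λ w → if P w then F ω' w else 0) + ∑ (λ w → if P w then 0 else F ω' w))
          ≡⟨ cong (λ z → ω x * z) (cong₂ _+_ (sum-cong-≗ P-part) (trans (far-side-part ω' x m px) (trans Q-part (sym (far-side-part ω x m px))))) ⟩
            ω x * (∑ (λ w → if P w then F ω w else 0) + ∑ (λ w → if P w then 0 else F ω w))
          ≡⟨ cong (ω x *_) (sym (∑-split {n} P (F ω))) ⟩
            ω x * ∑ (F ω)
          ≡⟨ sym (W-layered ω x m e) ⟩
            Wt ω (suc m) x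
          ∎ where
            open ≡-Reasoning
            F : (Fin n → ℕ) → Fin n → ℕ
            F ω₁ w = if adj G x w then (if eqn (ℓ w) m then Wt ω₁ m w else 0) else 0
            m≤k : m ≤ k
            m≤k = NP.≤-pred le
            P-part : ∀ w → (if P w then F ω' w else 0) ≡ (if P w then F ω w else 0)
            P-part w with P w in pw
            ... | false = refl
            ... | true with adj G x w
            ...   | false = refl
            ...   | true = eqn-cong (ℓ w) m _ _ (λ eq →
                      subst (λ z → Wt ω' z w ≡ Wt ω z w) eq (contraction-acc k w (subst (_≤ k) (sym eq) m≤k) pw))
            Q-part : (if BP x ∧ eqn (ℓ r) m then ∑ (λ w → if BQ w then ω' w else 0) * Kf ω' else 0)
                  ≡ (if BP x ∧ eqn (ℓ r) m then ∑ (λ w → if BQ w then ω w else 0) * Kf ω else 0)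
            Q-part with BP x
            ... | false = refl
            ... | true = eqn-cong (ℓ r) m _ _ (λ er → cong₂ _*_ (trans ω'-BQ-sum weight-r)
                      (Kf-eq (λ y py ey → contraction-acc k y (NP.≤-trans (NP.<⇒≤ (subst (suc (ℓ y) ≤_) er (NP.≤-reflexive ey))) m≤k) py)))

      opaque
        contraction : ∀ x → P x ≡ true → Agrees x
        contraction x = contraction-acc (ℓ x) x NP.≤-refl

      opaque
        contraction-r : Wt ω' (ℓ r) r ≡ ω' r * Kf ω
        contraction-r = trans (W-BQ ω' r r∈BQ) (cong (ω' r *_) (Kf-eq (λ y py _ → contraction y py)))

    opaque
      Q-nbr-notBQ : ∀ x w → Q x ≡ true → BQ x ≡ false → adj G x w ≡ true → P w ≡ false
      Q-nbr-notBQ x w qx bx a with P w in pw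
      ... | false = refl
      ... | true = ⊥-elim (t-f (P→BQ w x (trans (adj-sym w x) a) pw qx) bx)

    opaque
      cross-BQ : ∀ ω1 ω2 x → BQ x ≡ true → ω1 x ≡ ω2 x → Wt ω1 (ℓ x) x * Kf ω2 ≡ Wt ω2 (ℓ x) x * Kf ω1
      cross-BQ ω1 ω2 x bx hx = begin
          Wt ω1 (ℓ x) x * Kf ω2
        ≡⟨ cong (_* Kf ω2) (W-BQ ω1 x bx) ⟩
          ω1 x * Kf ω1 * Kf ω2
        ≡⟨ NP.*-assoc (ω1 x) (Kf ω1) (Kf ω2) ⟩
          ω1 x * (Kf ω1 * Kf ω2)
        ≡⟨ cong₂ _*_ hx (NP.*-comm (Kf ω1) (Kf ω2)) ⟩
          ω2 x * (Kf ω2 * Kf ω1)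
        ≡⟨ sym (NP.*-assoc (ω2 x) (Kf ω2) (Kf ω1)) ⟩
          ω2 x * Kf ω2 * Kf ω1
        ≡⟨ cong (_* Kf ω1) (sym (W-BQ ω2 x bx)) ⟩
          Wt ω2 (ℓ x) x * Kf ω1
        ∎ where open ≡-Reasoning

    opaque
      cross-gen : ∀ ω1 ω2 → (∀ x → Q x ≡ true → ω1 x ≡ ω2 x) → ∀ k x → ℓ x ≤ k → Q x ≡ true → ∀ b → BQ x ≡ b →
        Wt ω1 (ℓ x) x * Kf ω2 ≡ Wt ω2 (ℓ x) x * Kf ω1
      cross-gen ω1 ω2 h k x le qx true bx = cross-BQ ω1 ω2 x bx (h x qx)
      cross-gen ω1 ω2 h zero x le qx false bx = ⊥-elim (P-Q-disjoint t t∈P (subst (λ z → Q z ≡ true) (ℓ-0 x (NP.n≤0⇒n≡0 le)) qx))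
      cross-gen ω1 ω2 h (suc k') x le qx false bx = begin
            Wt ω1 (ℓ x) x * Kf ω2
          ≡⟨ cong (λ z → Wt ω1 z x * Kf ω2) e ⟩
            Wt ω1 (suc m) x * Kf ω2
          ≡⟨ cong (_* Kf ω2) (W-layered ω1 x m e) ⟩
            ω1 x * ∑ (F ω1) * Kf ω2
          ≡⟨ NP.*-assoc (ω1 x) (∑ (F ω1)) (Kf ω2) ⟩
            ω1 x * (∑ (F ω1) * Kf ω2)
          ≡⟨ cong₂ _*_ (h x qx) (trans (*-distribʳ-sum (Kf ω2) (F ω1)) (trans (sum-cong-≗ pointwise) (sym (*-distribʳ-sum (Kf ω1) (F ω2))))) ⟩
            ω2 x * (∑ (F ω2) * Kf ω1)
          ≡⟨ sym (NP.*-assoc (ω2 x) (∑ (F ω2)) (Kf ω1)) ⟩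
            ω2 x * ∑ (F ω2) * Kf ω1
          ≡⟨ cong (_* Kf ω1) (sym (W-layered ω2 x m e)) ⟩
            Wt ω2 (suc m) x * Kf ω1
          ≡⟨ cong (λ z → Wt ω2 z x * Kf ω1) (sym e) ⟩
            Wt ω2 (ℓ x) x * Kf ω1
          ∎ where
            open ≡-Reasoning
            m : ℕ
            m = proj₁ (Q-ℓ-suc x qx)
            e : ℓ x ≡ suc m
            e = proj₂ (Q-ℓ-suc x qx)
            F : (Fin n → ℕ) → Fin n → ℕ
            F ω₁ w = if adj G x w then (if eqn (ℓ w) m then Wt ω₁ m w else 0) else 0
            m≤k : m ≤ k'
            m≤k = NP.≤-pred (subst (_≤ suc k') e le)
            pointwise′ : ∀ w b → adj G x w ≡ b → (if b then (if eqn (ℓ w) m then Wt ω1 m w else 0) else 0) * Kf ω2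
                                        ≡ (if b then (if eqn (ℓ w) m then Wt ω2 m w else 0) else 0) * Kf ω1
            pointwise′ w false _ = refl
            pointwise′ w true a = eqn-cong-* (ℓ w) m (Wt ω1 m w) (Wt ω2 m w) (Kf ω2) (Kf ω1)
                (λ eq → subst (λ z → Wt ω1 z w * Kf ω2 ≡ Wt ω2 z w * Kf ω1) eq
                     (cross-gen ω1 ω2 h k' w (subst (_≤ k') (sym eq) m≤k) (¬P⇒Q w (Q-nbr-notBQ x w qx bx a)) (BQ w) refl))
            pointwise : ∀ w → F ω1 w * Kf ω2 ≡ F ω2 w * Kf ω1
            pointwise w = pointwise′ w (adj G x w) refl

    opaque
      cross-ratio : ∀ ω1 ω2 → (∀ x → Q x ≡ true → ω1 x ≡ ω2 x) → ∀ x → Q x ≡ true →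
        Wt ω1 (ℓ x) x * Kf ω2 ≡ Wt ω2 (ℓ x) x * Kf ω1
      cross-ratio ω1 ω2 h x qx = cross-gen ω1 ω2 h (ℓ x) x NP.≤-refl qx (BQ x) refl

    -- For weights ω that agree with ω0 on P (ω0 vanishing on Q), walk sums from P are affine
    -- in Sf ω = Σ_BQ ω, with a slope Qf independent of ω.
    module Affine (ω0 : Fin n → ℕ) (z0 : ∀ x → Q x ≡ true → ω0 x ≡ 0) where
      Sf : (Fin n → ℕ) → ℕ
      Sf ω = ∑ (λ c → if BQ c then ω c else 0)

      Qf : ℕ → Fin n → ℕ
      Qf zero x = 0
      Qf (suc m) x = ω0 x * (∑ (λ w → if P w then (if adj G x w then (if eqn (ℓ w) m then Qf m w else 0) else 0) else 0)
                            + (if BP x ∧ eqn (ℓ r) m then Kf ω0 else 0))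

      Sf0 : Sf ω0 ≡ 0
      Sf0 = trans (sum-cong-≗ pointwise) (sum-replicate-zero n)
        where pointwise : ∀ c → (if BQ c then ω0 c else 0) ≡ 0
              pointwise c with BQ c in bc
              ... | true = z0 c (BQ⊆Q c bc)
              ... | false = refl

      module _ (ω : Fin n → ℕ) (hω : ∀ x → P x ≡ true → ω x ≡ ω0 x) where
        low-acc : ∀ k x → ℓ x ≤ k → P x ≡ true → ℓ x < ℓ r → Wt ω (ℓ x) x ≡ Wt ω0 (ℓ x) x
        low-acc k x le px lt with ℓ x in e
        ... | zero with ℓ-0 x e
        ...   | refl = trans (W-0-eq ω t) (trans (hω t px) (sym (W-0-eq ω0 t)))
        low-acc (suc k) x le px lt | suc m = begin
            Wt ω (suc m) x
          ≡⟨ W-layered ω x m e ⟩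
            ω x * ∑ (F ω)
          ≡⟨ cong₂ _*_ (hω x px) (sum-cong-≗ pointwise) ⟩
            ω0 x * ∑ (F ω0)
          ≡⟨ sym (W-layered ω0 x m e) ⟩
            Wt ω0 (suc m) x
          ∎ where
            open ≡-Reasoning
            F : (Fin n → ℕ) → Fin n → ℕ
            F ω₁ w = if adj G x w then (if eqn (ℓ w) m then Wt ω₁ m w else 0) else 0
            pw' : ∀ w → ℓ w ≡ m → ∀ b → P w ≡ b → P w ≡ true
            pw' w eq true pw = pw
            pw' w eq false pw = ⊥-elim (NP.<-irrefl refl (NP.<-≤-trans (subst (_< ℓ r) (sym eq) (NP.<-trans (NP.n<1+n m) lt)) (BQ-closest r w r∈BQ (¬P⇒Q w pw))))
            pointwise′ : ∀ w b → adj G x w ≡ b → (if b then (if eqn (ℓ w) m then Wt ω m w else 0) else 0)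
                                        ≡ (if b then (if eqn (ℓ w) m then Wt ω0 m w else 0) else 0)
            pointwise′ w false _ = refl
            pointwise′ w true _ = eqn-cong (ℓ w) m (Wt ω m w) (Wt ω0 m w)
               (λ eq → subst (λ z → Wt ω z w ≡ Wt ω0 z w) eq
                  (low-acc k w (subst (_≤ k) (sym eq) (NP.≤-pred le)) (pw' w eq (P w) refl)
                     (subst (_< ℓ r) (sym eq) (NP.<-trans (NP.n<1+n m) lt))))
            pointwise : ∀ w → F ω w ≡ F ω0 w
            pointwise w = pointwise′ w (adj G x w) refl

        low : ∀ x → P x ≡ true → ℓ x < ℓ r → Wt ω (ℓ x) x ≡ Wt ω0 (ℓ x) x
        low x = low-acc (ℓ x) x NP.≤-refl

        Kf-low : Kf ω ≡ Kf ω0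
        Kf-low = sum-cong-≗ pointwise
          where pointwise : ∀ y → (if BP y then (if eqn (suc (ℓ y)) (ℓ r) then Wt ω (ℓ y) y else 0) else 0)
                          ≡ (if BP y then (if eqn (suc (ℓ y)) (ℓ r) then Wt ω0 (ℓ y) y else 0) else 0)
                pointwise y with BP y in by
                ... | false = refl
                ... | true = eqn-cong (suc (ℓ y)) (ℓ r) _ _ (λ eq → low y (BP⊆P y by) (subst (ℓ y <_) eq NP.≤-refl))

        affine-acc : ∀ k x → ℓ x ≤ k → P x ≡ true → Wt ω (ℓ x) x ≡ Wt ω0 (ℓ x) x + Sf ω * Qf (ℓ x) x
        affine-acc k x le px with ℓ x in e
        ... | zero with ℓ-0 x e
        ...   | refl = trans (W-0-eq ω t) (trans (hω t px) (sym (trans (cong (Wt ω0 0 t +_) (NP.*-zeroʳ (Sf ω))) (trans (NP.+-identityʳ _) (W-0-eq ω0 t)))))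
        affine-acc (suc k) x le px | suc m = begin
            Wt ω (suc m) x
          ≡⟨ W-layered ω x m e ⟩
            ω x * ∑ (F ω)
          ≡⟨ cong₂ _*_ (hω x px) (∑-split {n} P (F ω)) ⟩
            ω0 x * (∑ (λ w → if P w then F ω w else 0) + ∑ (λ w → if P w then 0 else F ω w))
          ≡⟨ cong (λ z → ω0 x * z) (cong₂ _+_ (trans (sum-cong-≗ P-part) (∑-distrib-+ G0 (λ w → Sf ω * GQ w))) (far-side-part ω x m px)) ⟩
            ω0 x * ((∑ G0 + ∑ (λ w → Sf ω * GQ w)) + (if BP x ∧ eqn (ℓ r) m then Sf ω * Kf ω else 0))
          ≡⟨ cong (λ z → ω0 x * ((∑ G0 + z) + (if BP x ∧ eqn (ℓ r) m then Sf ω * Kf ω else 0))) (sym (*-distribˡ-sum (Sf ω) GQ)) ⟩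
            ω0 x * ((∑ G0 + Sf ω * ∑ GQ) + (if BP x ∧ eqn (ℓ r) m then Sf ω * Kf ω else 0))
          ≡⟨ cong (λ z → ω0 x * ((∑ G0 + Sf ω * ∑ GQ) + (if BP x ∧ eqn (ℓ r) m then Sf ω * z else 0))) Kf-low ⟩
            ω0 x * ((∑ G0 + Sf ω * ∑ GQ) + (if BP x ∧ eqn (ℓ r) m then Sf ω * Kf ω0 else 0))
          ≡⟨ alg (BP x ∧ eqn (ℓ r) m) (ω0 x) (∑ G0) (Sf ω) (∑ GQ) (Kf ω0) ⟩
            ω0 x * (∑ G0 + (if BP x ∧ eqn (ℓ r) m then Sf ω0 * Kf ω0 else 0)) + Sf ω * Qf (suc m) x
          ≡⟨ cong (λ z → ω0 x * (∑ G0 + z) + Sf ω * Qf (suc m) x) (sym (far-side-part ω0 x m px)) ⟩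
            ω0 x * (∑ G0 + ∑ (λ w → if P w then 0 else F ω0 w)) + Sf ω * Qf (suc m) x
          ≡⟨ cong (λ z → ω0 x * z + Sf ω * Qf (suc m) x) (sym (∑-split {n} P (F ω0))) ⟩
            ω0 x * ∑ (F ω0) + Sf ω * Qf (suc m) x
          ≡⟨ cong (_+ Sf ω * Qf (suc m) x) (sym (W-layered ω0 x m e)) ⟩
            Wt ω0 (suc m) x + Sf ω * Qf (suc m) x
          ∎ where
            open ≡-Reasoning
            F : (Fin n → ℕ) → Fin n → ℕ
            F ω₁ w = if adj G x w then (if eqn (ℓ w) m then Wt ω₁ m w else 0) else 0
            G0 : Fin n → ℕ
            G0 w = if P w then F ω0 w else 0
            GQ : Fin n → ℕ
            GQ w = if P w then (if adj G x w then (if eqn (ℓ w) m then Qf m w else 0) else 0) else 0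
            alg : ∀ c a g s q K → a * ((g + s * q) + (if c then s * K else 0)) ≡
                     a * (g + (if c then Sf ω0 * K else 0)) + s * (a * (q + (if c then K else 0)))
            alg true a g s q K rewrite Sf0 = solve 5 (λ a g s q K → a :* ((g :+ s :* q) :+ s :* K) := a :* (g :+ con 0 :* K) :+ s :* (a :* (q :+ K))) refl a g s q K
              where open ℕ-Solver
            alg false a g s q K = solve 4 (λ a g s q → a :* ((g :+ s :* q) :+ con 0) := a :* (g :+ con 0) :+ s :* (a :* (q :+ con 0))) refl a g s q
              where open ℕ-Solver
            P-part′ : ∀ w b → P w ≡ b → (if b then F ω w else 0) ≡ G0 w + Sf ω * GQ w
            P-part′ w false pw rewrite pw = sym (NP.*-zeroʳ (Sf ω))
            P-part′ w true pw rewrite pw = by-adjacency (adj G x w) refl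
              where
              by-adjacency : ∀ b → adj G x w ≡ b → (if b then (if eqn (ℓ w) m then Wt ω m w else 0) else 0)
                     ≡ (if b then (if eqn (ℓ w) m then Wt ω0 m w else 0) else 0) + Sf ω * (if b then (if eqn (ℓ w) m then Qf m w else 0) else 0)
              by-adjacency false _ = sym (NP.*-zeroʳ (Sf ω))
              by-adjacency true _ = eqn-affine (ℓ w) m (Wt ω m w) (Wt ω0 m w) (Sf ω) (Qf m w)
                (λ eq → subst (λ z → Wt ω z w ≡ Wt ω0 z w + Sf ω * Qf z w) eq (affine-acc k w (subst (_≤ k) (sym eq) (NP.≤-pred le)) pw))
            P-part : ∀ w → (if P w then F ω w else 0) ≡ G0 w + Sf ω * GQ w
            P-part w = P-part′ w (P w) refl

        affine : ∀ x → P x ≡ true → Wt ω (ℓ x) x ≡ Wt ω0 (ℓ x) x + Sf ω * Qf (ℓ x) x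
        affine x = affine-acc (ℓ x) x NP.≤-refl

module SplitInstance where

  open NatSums
  open FinEquality
  open WalkSums
  open WalkSumProperties
  open Distance
  open DistanceLayers
  open SplitSide
  open import Data.Bool using (Bool; true; false; _∧_; _∨_; not; if_then_else_; T)
  open import Data.Bool.ListAction using (any; or)
  open import Data.Bool.Properties using (T-≡; not-involutive; ∨-zeroʳ)
  open import Data.Nat as ℕ using (ℕ; zero; suc; _+_; _*_; _≤_; _<_; NonZero)
  import Data.Nat.Properties as NP
  open import Data.Nat.Solver using () renaming (module +-*-Solver to ℕ-Solver)
  open import Data.Fin as F using (Fin; _≟_)
  open import Data.List using (map; allFin; tabulate)
  open import Data.Product using (_×_; _,_; proj₁; proj₂)
  open import Function using (_∘_; Equivalence)
  open import Relation.Nullary using (yes; no; ¬_)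
  open import Relation.Binary.PropositionalEquality

  open Equivalence using (to; from)

  opaque
    or-tabulate : ∀ {n m} (p : Fin n → Bool) (g : Fin m → Fin n) (x : Fin m) → p (g x) ≡ true → or (map p (tabulate g)) ≡ true
    or-tabulate p g F.zero e rewrite e = refl
    or-tabulate p g (F.suc x) e rewrite or-tabulate p (g ∘ F.suc) x e = ∨-zeroʳ (p (g F.zero))

    any-intro : ∀ {n} (p : Fin n → Bool) x → p x ≡ true → any p (allFin n) ≡ true
    any-intro p x e = or-tabulate p (λ y → y) x e

    ∧-intro : ∀ {a b} → a ≡ true → b ≡ true → (a ∧ b) ≡ true
    ∧-intro refl refl = refl

    ∧-l : ∀ {a b} → (a ∧ b) ≡ true → a ≡ true
    ∧-l {true} _ = refl

    not-f : ∀ {b} → b ≡ false → not b ≡ true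
    not-f refl = refl

    not-t' : ∀ {b} → not b ≡ true → b ≡ false
    not-t' {false} _ = refl

  module Setting {n : ℕ} (G : WGraph n) (allv : ∀ v → vert G v ≡ true) (simple : IsSimple (adj G)) (conn : Connected G)
           (nz : ∀ v → NonZero (α G v)) (A : Fin n → Bool) (split : IsSplit (adj G) A)
           (a b : Fin n) (aC : T (inN (adj G) (λ x → not (A x)) a)) (bD : T (inN (adj G) A b)) (v : Fin n) (vA : T (A v)) where

    adj-sym : ∀ u w → adj G u w ≡ adj G w u
    adj-sym = proj₁ simple

    pos : ∀ x → ¬ α G x ≡ 0
    pos x = ℕ.≢-nonZero⁻¹ (α G x) {{nz x}}

    inB : Fin n → Bool
    inB x = not (A x)

    inC : Fin n → Bool
    inC = inN (adj G) inB

    inD : Fin n → Bool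
    inD = inN (adj G) A

    opaque
      C-D-complete : ∀ c d → inC c ≡ true → inD d ≡ true → adj G c d ≡ true
      C-D-complete c d cc dd = trans (adj-sym c d) (to T-≡ (proj₂ (proj₂ split) d c (from T-≡ dd) (from T-≡ cc)))

      C⊆A : ∀ x → inC x ≡ true → A x ≡ true
      C⊆A x e = trans (sym (not-involutive (A x))) (∧-l e)

      D⊆B : ∀ x → inD x ≡ true → inB x ≡ true
      D⊆B x e = ∧-l e

      A-B-edge⇒C : ∀ u w → adj G u w ≡ true → A u ≡ true → inB w ≡ true → inC u ≡ true
      A-B-edge⇒C u w e au bw = ∧-intro (trans (not-involutive (A u)) au) (any-intro _ w (∧-intro bw e))

      B-A-edge⇒D : ∀ u w → adj G u w ≡ true → inB u ≡ true → A w ≡ true → inD u ≡ true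
      B-A-edge⇒D u w e bu aw = ∧-intro bu (any-intro _ w (∧-intro aw e))

    a∈C : inC a ≡ true
    a∈C = to T-≡ aC
    b∈D : inD b ≡ true
    b∈D = to T-≡ bD
    v∈A : A v ≡ true
    v∈A = to T-≡ vA

    module SideA (t : Fin n) (tA : A t ≡ true) = SideOfSplit G allv adj-sym conn pos t A inB inC inD tA (λ x → refl)
       (λ u w e bu aw → A-B-edge⇒C w u (trans (adj-sym w u) e) aw bu) C⊆A D⊆B C-D-complete
       (λ u w e au bw → B-A-edge⇒D w u (trans (adj-sym w u) e) bw au) b b∈D

    module SideB (t : Fin n) (tB : A t ≡ false) = SideOfSplit G allv adj-sym conn pos t inB A inD inC (not-f tB) (λ x → sym (not-involutive (A x)))
       (λ u w e au bw → B-A-edge⇒D w u (trans (adj-sym w u) e) bw au) D⊆B C⊆A (λ c d dc cd → trans (adj-sym c d) (C-D-complete d c cd dc))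
       (λ u w e bu aw → A-B-edge⇒C w u (trans (adj-sym w u) e) aw bu) a a∈C

    GA' : WGraph n
    GA' = GA G A b
    GB' : WGraph n
    GB' = GB G A a

    ωG ωGv ωGA ωGAv ωGB ωGBa : Fin n → ℕ
    ωG = weight G
    ωGv = weight (avoid G v)
    ωGA = weight GA'
    ωGAv = weight (avoid GA' v)
    ωGB = weight GB'
    ωGBa = weight (avoid GB' a)

    ΣD ΣC : ℕ
    ΣD = sumOver inD (α G)
    ΣC = sumOver inC (α G)

    opaque
      sumOver-∑ : ∀ (S : Fin n → Bool) (f : Fin n → ℕ) → sumOver S f ≡ ∑ (λ x → if S x then f x else 0)
      sumOver-∑ S f = trans (listSum-filt f S (allFin n)) (listSum-allFin {n} _)

      ωG-α : ∀ x → ωG x ≡ α G x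
      ωG-α x rewrite allv x = refl

      b∉A : A b ≡ false
      b∉A = not-t' (D⊆B b b∈D)

      v≢b : ¬ v ≡ b
      v≢b e = t-f v∈A (subst (λ z → A z ≡ false) (sym e) b∉A)

      a∈A : A a ≡ true
      a∈A = C⊆A a a∈C

      A-≢b : ∀ x → A x ≡ true → ¬ x ≡ b
      A-≢b x ax e = t-f ax (subst (λ z → A z ≡ false) (sym e) b∉A)

      B-≢a : ∀ x → A x ≡ false → ¬ x ≡ a
      B-≢a x bx e = t-f a∈A (subst (λ z → A z ≡ false) e bx)

      B-≢v : ∀ x → A x ≡ false → ¬ x ≡ v
      B-≢v x bx e = t-f v∈A (subst (λ z → A z ≡ false) e bx)

      sumOver-≢0 : ∀ S x → S x ≡ true → ¬ sumOver S (α G) ≡ 0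
      sumOver-≢0 S x x∈S e = pos x (NP.n≤0⇒n≡0 (begin
        α G x                               ≡⟨ cong (λ c → if c then α G x else 0) x∈S ⟨
        (if S x then α G x else 0)          ≤⟨ ∑-≥ (λ y → if S y then α G y else 0) x ⟩
        ∑ (λ y → if S y then α G y else 0)  ≡⟨ sumOver-∑ S (α G) ⟨
        sumOver S (α G)                     ≡⟨ e ⟩
        0                                   ∎))
        where open NP.≤-Reasoning

      ΣD-pos : ¬ ΣD ≡ 0
      ΣD-pos = sumOver-≢0 inD b b∈D

      ΣC-pos : ¬ ΣC ≡ 0
      ΣC-pos = sumOver-≢0 inC a a∈C

      posGA : ∀ x → ¬ α GA' x ≡ 0
      posGA x with x == b
      ... | true = ΣD-pos
      ... | false = pos x

      posGB : ∀ x → ¬ α GB' x ≡ 0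
      posGB x with x == a
      ... | true = ΣC-pos
      ... | false = pos x

      ωGA-A : ∀ x → A x ≡ true → ωGA x ≡ ωG x
      ωGA-A x ax rewrite ax | ==-≢ (A-≢b x ax) | allv x = refl

      ωGA-B : ∀ x → A x ≡ false → ¬ x ≡ b → ωGA x ≡ 0
      ωGA-B x bx ne rewrite bx | ==-≢ ne = refl

      ωGA-b : ωGA b ≡ ∑ (λ d → if inD d then ωG d else 0)
      ωGA-b rewrite ==-refl b | b∉A = trans (sumOver-∑ inD (α G)) (sum-cong-≗ (λ d → cong (λ z → if inD d then z else 0) (sym (ωG-α d))))

      ωGAv-A : ∀ x → A x ≡ true → ωGAv x ≡ ωGv x
      ωGAv-A x ax rewrite ax | ==-≢ (A-≢b x ax) | allv x = refl

      ωGAv-B : ∀ x → A x ≡ false → ¬ x ≡ b → ωGAv x ≡ 0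
      ωGAv-B x bx ne rewrite bx | ==-≢ ne = refl

      ωGAv-b : ωGAv b ≡ ∑ (λ d → if inD d then ωGv d else 0)
      ωGAv-b rewrite ==-refl b | b∉A | ==-≢ (λ e → v≢b (sym e)) = trans (sumOver-∑ inD (α G)) (sum-cong-≗ pointwise)
        where pointwise : ∀ d → (if inD d then α G d else 0) ≡ (if inD d then ωGv d else 0)
              pointwise d with inD d in dd
              ... | false = refl
              ... | true rewrite allv d | ==-≢ (B-≢v d (not-t' (D⊆B d dd))) = refl

      ωGA-b' : ωGA b ≡ ΣD
      ωGA-b' rewrite ==-refl b | b∉A = refl

      ωGAv-b' : ωGAv b ≡ ΣD
      ωGAv-b' rewrite ==-refl b | b∉A | ==-≢ (λ e → v≢b (sym e)) = refl

      ωGv-B : ∀ x → A x ≡ false → ωG x ≡ ωGv x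
      ωGv-B x bx rewrite allv x | ==-≢ (B-≢v x bx) = refl

    -- Target t ∈ A: σ and σ(·,·,v) of G_A agree with those of G for sources in A, and
    -- the source b of G_A represents all sources in B (through the boundary factor Kf).
    module TargetInA (t : Fin n) (tA : A t ≡ true) where
      open SideA t tA public hiding (ωG)
      module ContractG = Contraction ωG ωGA ωGA-A ωGA-B ωGA-b
      module ContractGv = Contraction ωGv ωGAv ωGAv-A ωGAv-B ωGAv-b

      opaque
        dist-GA : ∀ s → ¬ Wt ωGA (ℓ s) s ≡ 0 → dist GA' s t ≡ ℓ s
        dist-GA s ne = dist-char GA' posGA s t (ℓ s) (NP.<⇒≤ (ℓ-<n s)) ne (λ j lt → zero-below ωGA j s lt)

        σG : ∀ s → σ G s t ≡ Wt ωG (ℓ s) s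
        σG s = trans (σ≡W G s t) (cong (λ k → W (adj G) ωG k s t) (sym (ℓ-def s)))

        splitG : ∀ s → σv G s t v + Wt ωGv (ℓ s) s ≡ Wt ωG (ℓ s) s
        splitG s = trans (cong (λ k → σv G s t v + W (adj G) ωGv k s t) (ℓ-def s)) (trans (σv+avoiding≡σ G v s t) (σG s))

        σGA : ∀ s → ¬ Wt ωGA (ℓ s) s ≡ 0 → σ GA' s t ≡ Wt ωGA (ℓ s) s
        σGA s ne = trans (σ≡W GA' s t) (cong (λ k → W (adj G) ωGA k s t) (dist-GA s ne))

        splitGA : ∀ s → ¬ Wt ωGA (ℓ s) s ≡ 0 → σv GA' s t v + Wt ωGAv (ℓ s) s ≡ Wt ωGA (ℓ s) s
        splitGA s ne = trans (cong (λ k → σv GA' s t v + W (adj G) ωGAv k s t) (sym (dist-GA s ne))) (trans (σv+avoiding≡σ GA' v s t) (σGA s ne))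

        W-A≢0 : ∀ s → A s ≡ true → ¬ Wt ωGA (ℓ s) s ≡ 0
        W-A≢0 s as e = ℓ-ne s (trans (sym (ContractG.contraction s as)) e)

        AA-σ : ∀ s → A s ≡ true → σ GA' s t ≡ σ G s t
        AA-σ s as = trans (σGA s (W-A≢0 s as)) (trans (ContractG.contraction s as) (sym (σG s)))

        AA-σv : ∀ s → A s ≡ true → σv GA' s t v ≡ σv G s t v
        AA-σv s as = NP.+-cancelʳ-≡ _ _ _ (trans (splitGA s (W-A≢0 s as)) (trans (ContractG.contraction s as)
                       (trans (sym (splitG s)) (cong (σv G s t v +_) (sym (ContractGv.contraction s as))))))

        Kf≢0 : ¬ Kf ωG ≡ 0
        Kf≢0 e = ℓ-ne b (trans (W-BQ ωG b b∈D) (trans (cong (ωG b *_) e) (NP.*-zeroʳ (ωG b))))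

        W-b≢0 : ¬ Wt ωGA (ℓ b) b ≡ 0
        W-b≢0 e = *≢0 {ωGA b} (λ e' → ΣD-pos (trans (sym ωGA-b') e')) Kf≢0 (trans (sym ContractG.contraction-r) e)

        σGA-b : σ GA' b t ≡ ΣD * Kf ωG
        σGA-b = trans (σGA b W-b≢0) (trans ContractG.contraction-r (cong (_* Kf ωG) ωGA-b'))

        splitGA-b : σv GA' b t v + ΣD * Kf ωGv ≡ ΣD * Kf ωG
        splitGA-b = trans (cong (σv GA' b t v +_) (sym (trans ContractGv.contraction-r (cong (_* Kf ωGv) ωGAv-b')))) (trans (splitGA b W-b≢0) (trans ContractG.contraction-r (cong (_* Kf ωG) ωGA-b')))

        crossB : ∀ s → A s ≡ false → Wt ωG (ℓ s) s * Kf ωGv ≡ Wt ωGv (ℓ s) s * Kf ωG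
        crossB s bs = cross-ratio ωG ωGv (λ x qx → ωGv-B x (not-t' qx)) s (not-f bs)

    opaque
      ωGBa-A : ∀ x → A x ≡ true → ωGBa x ≡ 0
      ωGBa-A x nx rewrite nx with x == a
      ... | true = refl
      ... | false = refl

      ωGBa-B : ∀ x → inB x ≡ true → ωGBa x ≡ α G x
      ωGBa-B x nx rewrite nx | ==-≢ (B-≢a x (not-t' nx)) = refl

      hωG : ∀ x → inB x ≡ true → ωG x ≡ ωGBa x
      hωG x nx = trans (ωG-α x) (sym (ωGBa-B x nx))

      hωGv : ∀ x → inB x ≡ true → ωGv x ≡ ωGBa x
      hωGv x nx = trans (sym (ωGv-B x (not-t' nx))) (hωG x nx)

      hωGB : ∀ x → inB x ≡ true → ωGB x ≡ ωGBa x
      hωGB x nx rewrite nx | ==-≢ (B-≢a x (not-t' nx)) = refl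

      SfG : ∑ (λ c → if inC c then ωG c else 0) ≡ ΣC
      SfG = trans (sum-cong-≗ (λ c → cong (λ z → if inC c then z else 0) (ωG-α c))) (sym (sumOver-∑ inC (α G)))

      SfGB : ∑ (λ c → if inC c then ωGB c else 0) ≡ ΣC
      SfGB = trans (sum-cong-≗ pointwise) (∑-δ a (λ _ → ΣC))
        where pointwise : ∀ c → (if inC c then ωGB c else 0) ≡ (if c == a then ΣC else 0)
              pointwise c with c ≟ a
              ... | yes refl rewrite a∈C | a∈A = refl
              ... | no _ with inC c in cc
              ...   | false = refl
              ...   | true rewrite C⊆A c cc = refl

      SfGv : ∑ (λ c → if inC c then ωGv c else 0) + (if inC v then α G v else 0) ≡ ΣC
      SfGv = trans (cong (∑ (λ c → if inC c then ωGv c else 0) +_) (sym (∑-δ v (λ c → if inC c then α G c else 0))))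
               (trans (sym (∑-distrib-+ (λ c → if inC c then ωGv c else 0) (λ c → if c == v then (if inC c then α G c else 0) else 0))) (trans (sum-cong-≗ pointwise) (sym (sumOver-∑ inC (α G)))))
        where pointwise : ∀ c → (if inC c then ωGv c else 0) + (if c == v then (if inC c then α G c else 0) else 0) ≡ (if inC c then α G c else 0)
              pointwise c rewrite allv c with c ≟ v
              ... | yes refl with inC v
              ...   | true = refl
              ...   | false = refl
              pointwise c | no _ with inC c
              ...   | true = NP.+-identityʳ _
              ...   | false = refl

    -- Target t ∈ B: for sources s ∈ B all walk sums are affine in the total weight of C,
    -- which yields σ_{G_B}(s,t) = σ_G(s,t) and σ_G(s,t,v)·ΣC = [v ∈ C]α(v)·σ_{G_B}(s,t,a).
    module TargetInB (t : Fin n) (tB : A t ≡ false) where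
      open SideB t tB public hiding (ωG)
      open Affine ωGBa ωGBa-A public

      opaque
        σG : ∀ s → σ G s t ≡ Wt ωG (ℓ s) s
        σG s = trans (σ≡W G s t) (cong (λ k → W (adj G) ωG k s t) (sym (ℓ-def s)))

        splitG : ∀ s → σv G s t v + Wt ωGv (ℓ s) s ≡ Wt ωG (ℓ s) s
        splitG s = trans (cong (λ k → σv G s t v + W (adj G) ωGv k s t) (ℓ-def s)) (trans (σv+avoiding≡σ G v s t) (σG s))

        affG : ∀ s → inB s ≡ true → Wt ωG (ℓ s) s ≡ Wt ωGBa (ℓ s) s + ΣC * Qf (ℓ s) s
        affG s ns = trans (affine ωG hωG s ns) (cong (λ z → Wt ωGBa (ℓ s) s + z * Qf (ℓ s) s) SfG)

        affGB : ∀ s → inB s ≡ true → Wt ωGB (ℓ s) s ≡ Wt ωGBa (ℓ s) s + ΣC * Qf (ℓ s) s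
        affGB s ns = trans (affine ωGB hωGB s ns) (cong (λ z → Wt ωGBa (ℓ s) s + z * Qf (ℓ s) s) SfGB)

        affGv : ∀ s → inB s ≡ true → Wt ωGv (ℓ s) s ≡ Wt ωGBa (ℓ s) s + Sf ωGv * Qf (ℓ s) s
        affGv s ns = affine ωGv hωGv s ns

        dist-GB : ∀ s → inB s ≡ true → dist GB' s t ≡ ℓ s
        dist-GB s ns = dist-char GB' posGB s t (ℓ s) (NP.<⇒≤ (ℓ-<n s)) (λ e → ℓ-ne s (trans (affG s ns) (trans (sym (affGB s ns)) e)))
                         (λ j lt → zero-below ωGB j s lt)

        BB-σ : ∀ s → inB s ≡ true → σ GB' s t ≡ σ G s t
        BB-σ s ns = trans (σ≡W GB' s t) (trans (cong (λ k → W (adj G) ωGB k s t) (dist-GB s ns))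
                      (trans (affGB s ns) (trans (sym (affG s ns)) (sym (σG s)))))

        BB-σvGB : ∀ s → inB s ≡ true → σv GB' s t a ≡ ΣC * Qf (ℓ s) s
        BB-σvGB s ns = NP.+-cancelʳ-≡ _ _ _ (trans (cong (λ k → σv GB' s t a + W (adj G) ωGBa k s t) (sym (dist-GB s ns)))
                          (trans (σv+avoiding≡σ GB' a s t) (trans (σ≡W GB' s t) (trans (cong (λ k → W (adj G) ωGB k s t) (dist-GB s ns))
                          (trans (affGB s ns) (NP.+-comm (Wt ωGBa (ℓ s) s) (ΣC * Qf (ℓ s) s)))))))

        BB-σvG : ∀ s → inB s ≡ true → σv G s t v ≡ (if inC v then α G v else 0) * Qf (ℓ s) s
        BB-σvG s ns = NP.+-cancelʳ-≡ _ _ _ (begin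
            σv G s t v + (Wt ωGBa (ℓ s) s + Sf ωGv * Qf (ℓ s) s)
          ≡⟨ cong (σv G s t v +_) (sym (affGv s ns)) ⟩
            σv G s t v + Wt ωGv (ℓ s) s
          ≡⟨ splitG s ⟩
            Wt ωG (ℓ s) s
          ≡⟨ affG s ns ⟩
            Wt ωGBa (ℓ s) s + ΣC * Qf (ℓ s) s
          ≡⟨ cong (λ z → Wt ωGBa (ℓ s) s + z * Qf (ℓ s) s) (sym SfGv) ⟩
            Wt ωGBa (ℓ s) s + (Sf ωGv + (if inC v then α G v else 0)) * Qf (ℓ s) s
          ≡⟨ alg (Wt ωGBa (ℓ s) s) (Sf ωGv) (if inC v then α G v else 0) (Qf (ℓ s) s) ⟩
            (if inC v then α G v else 0) * Qf (ℓ s) s + (Wt ωGBa (ℓ s) s + Sf ωGv * Qf (ℓ s) s)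
          ∎)
          where
            open ≡-Reasoning
            open ℕ-Solver
            alg : ∀ w f c q → w + (f + c) * q ≡ c * q + (w + f * q)
            alg = solve 4 (λ w f c q → w :+ (f :+ c) :* q := c :* q :+ (w :+ f :* q)) refl

        BB-rel : ∀ s → inB s ≡ true → σv G s t v * ΣC ≡ (if inC v then α G v else 0) * σv GB' s t a
        BB-rel s ns rewrite BB-σvG s ns | BB-σvGB s ns =
          trans (NP.*-assoc (if inC v then α G v else 0) _ ΣC) (cong ((if inC v then α G v else 0) *_) (NP.*-comm (Qf (ℓ s) s) ΣC))

module PairDecomposition where

  open import Data.Bool using (Bool; true; false; _∧_; _∨_; not; if_then_else_)
  open import Data.Rational using (ℚ; 0ℚ) renaming (_+_ to _+ℚ_)
  import Data.Rational.Properties as QP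
  open import Relation.Binary.PropositionalEquality

  private
    true≢false : true ≡ false → ∀ {A : Set} → A
    true≢false ()

    only₁ : ∀ X → X ≡ ((X +ℚ 0ℚ) +ℚ 0ℚ) +ℚ 0ℚ
    only₁ X = sym (trans (QP.+-identityʳ _) (trans (QP.+-identityʳ _) (QP.+-identityʳ X)))
    only₂ : ∀ X → X ≡ ((0ℚ +ℚ X) +ℚ 0ℚ) +ℚ 0ℚ
    only₂ X = sym (trans (QP.+-identityʳ _) (trans (QP.+-identityʳ _) (QP.+-identityˡ X)))
    only₃ : ∀ X → X ≡ ((0ℚ +ℚ 0ℚ) +ℚ X) +ℚ 0ℚ
    only₃ X = sym (trans (QP.+-identityʳ _) (QP.+-identityˡ X))
    only₄ : ∀ X → X ≡ ((0ℚ +ℚ 0ℚ) +ℚ 0ℚ) +ℚ X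
    only₄ X = sym (QP.+-identityˡ X)

  -- In G: as, at say s, t ∈ A; sv, tv say s = v, t = v (and v ∈ A).
  decompose-G : ∀ (as at sv tv : Bool) (X : ℚ) → (as ≡ false → sv ≡ false) → (at ≡ false → tv ≡ false) →
    (if not sv ∧ not tv then X else 0ℚ) ≡
    (((if as ∧ at ∧ not sv ∧ not tv then X else 0ℚ) +ℚ (if as ∧ not sv then (if at then 0ℚ else X) else 0ℚ))
     +ℚ (if at ∧ not tv then (if as then 0ℚ else X) else 0ℚ)) +ℚ (if as then 0ℚ else (if at then 0ℚ else X))
  decompose-G true  true  true  true  X _ _ = refl
  decompose-G true  true  true  false X _ _ = refl
  decompose-G true  true  false true  X _ _ = refl
  decompose-G true  true  false false X _ _ = only₁ X
  decompose-G true  false sv    true  X _ t≢v = true≢false (t≢v refl)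
  decompose-G true  false true  false X _ _ = refl
  decompose-G true  false false false X _ _ = only₂ X
  decompose-G false at    true  tv    X s≢v _ = true≢false (s≢v refl)
  decompose-G false true  false true  X _ _ = refl
  decompose-G false true  false false X _ _ = only₃ X
  decompose-G false false false true  X _ t≢v = true≢false (t≢v refl)
  decompose-G false false false false X _ _ = only₄ X

  -- In G_A: additionally sb, tb say s = b, t = b for the contracted vertex b ∉ A, b ≠ v.
  decompose-GA : ∀ (as sb sv at tb tv : Bool) (X : ℚ) →
    (sb ≡ true → as ≡ false) → (sb ≡ true → sv ≡ false) → (tb ≡ true → at ≡ false) → (tb ≡ true → tv ≡ false) →
    (if (as ∨ sb) ∧ (at ∨ tb) ∧ not sv ∧ not tv then X else 0ℚ) ≡
    (((if as ∧ at ∧ not sv ∧ not tv then X else 0ℚ) +ℚ (if as ∧ not sv then (if tb then X else 0ℚ) else 0ℚ))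
     +ℚ (if at ∧ not tv then (if sb then X else 0ℚ) else 0ℚ)) +ℚ (if sb then (if tb then X else 0ℚ) else 0ℚ)
  decompose-GA as true sv at true tv X s∉A s≢v t∉A t≢v
    rewrite s∉A refl | s≢v refl | t∉A refl | t≢v refl = only₄ X
  decompose-GA as true sv true  false true  X s∉A s≢v _ _ rewrite s∉A refl | s≢v refl = refl
  decompose-GA as true sv true  false false X s∉A s≢v _ _ rewrite s∉A refl | s≢v refl = only₃ X
  decompose-GA as true sv false false tv    X s∉A _ _ _ rewrite s∉A refl = refl
  decompose-GA true  false true  at true tv X _ _ t∉A _ rewrite t∉A refl = refl
  decompose-GA true  false false at true tv X _ _ t∉A t≢v rewrite t∉A refl | t≢v refl = only₂ X
  decompose-GA false false sv    at true tv X _ _ t∉A _ rewrite t∉A refl = refl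
  decompose-GA true  false true  true  false true  X _ _ _ _ = refl
  decompose-GA true  false true  true  false false X _ _ _ _ = refl
  decompose-GA true  false true  false false true  X _ _ _ _ = refl
  decompose-GA true  false true  false false false X _ _ _ _ = refl
  decompose-GA true  false false true  false true  X _ _ _ _ = refl
  decompose-GA true  false false true  false false X _ _ _ _ = only₁ X
  decompose-GA true  false false false false true  X _ _ _ _ = refl
  decompose-GA true  false false false false false X _ _ _ _ = refl
  decompose-GA false false true  true  false true  X _ _ _ _ = refl
  decompose-GA false false true  true  false false X _ _ _ _ = refl
  decompose-GA false false true  false false true  X _ _ _ _ = refl
  decompose-GA false false true  false false false X _ _ _ _ = refl
  decompose-GA false false false true  false true  X _ _ _ _ = refl
  decompose-GA false false false true  false false X _ _ _ _ = refl
  decompose-GA false false false false false true  X _ _ _ _ = refl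
  decompose-GA false false false false false false X _ _ _ _ = refl

  -- In G_B: as, at say s, t ∈ A; sa, ta say s = a, t = a for the contracted vertex a ∈ A.
  decompose-GB : ∀ (as sa at ta : Bool) (X : ℚ) → (sa ≡ true → as ≡ true) → (ta ≡ true → at ≡ true) →
    (if (not as ∨ sa) ∧ (not at ∨ ta) ∧ not sa ∧ not ta then X else 0ℚ) ≡ (if as then 0ℚ else (if at then 0ℚ else X))
  decompose-GB true  true  true  true  X _ _ = refl
  decompose-GB true  true  true  false X _ _ = refl
  decompose-GB true  false true  true  X _ _ = refl
  decompose-GB true  false true  false X _ _ = refl
  decompose-GB true  true  false true  X _ t∈A = true≢false (sym (t∈A refl))
  decompose-GB true  true  false false X _ _ = refl
  decompose-GB true  false false true  X _ t∈A = true≢false (sym (t∈A refl))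
  decompose-GB true  false false false X _ _ = refl
  decompose-GB false true  at    ta    X s∈A _ = true≢false (sym (s∈A refl))
  decompose-GB false false true  true  X _ _ = refl
  decompose-GB false false true  false X _ _ = refl
  decompose-GB false false false true  X _ t∈A = true≢false (sym (t∈A refl))
  decompose-GB false false false false X _ _ = refl

module Comparison where

  open NatSums
  open FinEquality
  open Fractions
  open RationalSums
  open WalkSums
  open WalkSumProperties
  open Distance
  open DistanceLayers
  open SplitSide
  open SplitInstance
  open PairDecomposition
  open import Data.Bool using (Bool; true; false; _∧_; not; if_then_else_; T)
  open import Data.Nat as ℕ using (ℕ; _+_; _*_; _∸_; _≤_; z≤n; NonZero)
  import Data.Nat.Properties as NP
  open import Data.Nat.Solver using () renaming (module +-*-Solver to ℕ-Solver)
  open import Data.Rational.Solver using () renaming (module +-*-Solver to ℚ-Solver)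
  open import Data.Fin as F using (Fin)
  open import Data.List using (allFin)
  open import Data.Rational using (ℚ; 0ℚ; 1ℚ) renaming (_+_ to _+ℚ_; _*_ to _*ℚ_)
  import Data.Rational.Properties as QP
  open import Data.Product using (_×_; _,_)
  open import Relation.Nullary using (¬_)
  open import Relation.Binary.PropositionalEquality

  pairTerm : ∀ {n} → WGraph n → Fin n → Fin n → Fin n → ℚ
  pairTerm H u s t = frac (β H s * β H t * σv H s t u) (σ H s t)

  pairGuard : ∀ {n} → WGraph n → Fin n → Fin n → Fin n → Bool
  pairGuard H u s t = vert H s ∧ vert H t ∧ not (s == u) ∧ not (t == u)

  opaque
    BC-double-sum : ∀ {n} (H : WGraph n) u → BC H u ≡ frac 1 (α H u) *ℚ ∑ℚ (λ s → ∑ℚ (λ t → if pairGuard H u s t then pairTerm H u s t else 0ℚ))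
    BC-double-sum {n} H u = cong (frac 1 (α H u) *ℚ_) (trans (listSumℚ-filt _ _ (pairs (allFin n))) (listSumℚ-pairs {n} _))

    -- from σ_v + σ_{avoiding v} = σ and a cross-multiplication for σ_{avoiding v}, one for σ_v
    cross-∸ : ∀ X Y Z K Kv → X + Y ≡ Z → Z * Kv ≡ Y * K → X * K ≡ (K ∸ Kv) * Z
    cross-∸ X Y Z K Kv e1 e2 = sym (begin
        (K ∸ Kv) * Z
      ≡⟨ NP.*-distribʳ-∸ Z K Kv ⟩
        K * Z ∸ Kv * Z
      ≡⟨ cong₂ _∸_ (NP.*-comm K Z) (trans (NP.*-comm Kv Z) e2) ⟩
        Z * K ∸ Y * K
      ≡⟨ sym (NP.*-distribʳ-∸ K Z Y) ⟩
        (Z ∸ Y) * K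
      ≡⟨ cong (_* K) (trans (cong (_∸ Y) (sym e1)) (NP.m+n∸n≡m X Y)) ⟩
        X * K
      ∎) where open ≡-Reasoning

    cross-scale : ∀ p q X K D Z → X * K ≡ D * Z → p * q * X * K ≡ p * (q * D) * Z
    cross-scale p q X K D Z e = begin
        p * q * X * K
      ≡⟨ NP.*-assoc (p * q) X K ⟩
        p * q * (X * K)
      ≡⟨ cong (p * q *_) e ⟩
        p * q * (D * Z)
      ≡⟨ solve 4 (λ p q D Z → p :* q :* (D :* Z) := p :* (q :* D) :* Z) refl p q D Z ⟩
        p * (q * D) * Z
      ∎ where open ≡-Reasoning
              open ℕ-Solver

  module Contributions {n : ℕ} (G : WGraph n) (allv : ∀ v → vert G v ≡ true) (simple : IsSimple (adj G)) (conn : Connected G)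
           (nz : ∀ v → NonZero (α G v)) (A : Fin n → Bool) (split : IsSplit (adj G) A)
           (a b : Fin n) (aC : T (inN (adj G) (λ x → not (A x)) a)) (bD : T (inN (adj G) A b)) (v : Fin n) (vA : T (A v)) where
    open Setting G allv simple conn nz A split a b aC bD v vA public
    module SyG = Symmetry G pos adj-sym
    module SyGA = Symmetry GA' posGA adj-sym

    opaque
      pairTerm-sym-G : ∀ s t → pairTerm G v s t ≡ pairTerm G v t s
      pairTerm-sym-G s t = cong₂ frac (cong₂ _*_ (NP.*-comm (β G s) (β G t)) (SyG.σv-sym v s t)) (SyG.σ-sym s t)

      pairTerm-sym-GA : ∀ s t → pairTerm GA' v s t ≡ pairTerm GA' v t s
      pairTerm-sym-GA s t = cong₂ frac (cong₂ _*_ (NP.*-comm (β GA' s) (β GA' t)) (SyGA.σv-sym v s t)) (SyGA.σ-sym s t)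

      βGA-A : ∀ x → A x ≡ true → β GA' x ≡ β G x
      βGA-A x ax rewrite ==-≢ (A-≢b x ax) = refl

      βGB-B : ∀ x → A x ≡ false → β GB' x ≡ β G x
      βGB-B x bx rewrite ==-≢ (B-≢a x bx) = refl

      pairTerm-AA : ∀ s t → A s ≡ true → (tA : A t ≡ true) → pairTerm GA' v s t ≡ pairTerm G v s t
      pairTerm-AA s t as tA rewrite βGA-A s as | βGA-A t tA | TargetInA.AA-σv t tA s as | TargetInA.AA-σ t tA s as = refl

      σv-GA-bb : σv GA' b b v ≡ 0
      σv-GA-bb = NP.+-cancelʳ-≡ _ _ _ (trans (cong (λ k → σv GA' b b v + W (adj G) ωGAv k b b) (sym dist-bb))
         (trans (σv+avoiding≡σ GA' v b b) (trans (σ≡W GA' b b) (trans (cong (λ k → W (adj G) ωGA k b b) dist-bb)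
         (trans (WalkSupport.W-0-eq (adj G) ωGA b) (trans ωGA-b' (trans (sym ωGAv-b') (sym (WalkSupport.W-0-eq (adj G) ωGAv b)))))))))
        where dist-bb : dist GA' b b ≡ 0
              dist-bb = dist-char GA' posGA b b 0 z≤n (λ e → ΣD-pos (trans (sym ωGA-b') (trans (sym (WalkSupport.W-0-eq (adj G) ωGA b)) e))) (λ j ())

      pairTerm-bb : pairTerm GA' v b b ≡ 0ℚ
      pairTerm-bb rewrite σv-GA-bb | NP.*-zeroʳ (β GA' b * β GA' b) = frac-0 (σ GA' b b)

      βGA-b : β GA' b ≡ ∑ (λ s → if A s then 0 else β G s)
      βGA-b rewrite ==-refl b = trans (sumOver-∑ inB (β G)) (sum-cong-≗ pointwise)
        where pointwise : ∀ s → (if inB s then β G s else 0) ≡ (if A s then 0 else β G s)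
              pointwise s with A s
              ... | true = refl
              ... | false = refl

    -- For t ∈ A, the sources s ∈ B of G together contribute what the single source b does in G_A:
    -- all their terms are β(s)·Y/K for one Y and K (the boundary factor), and β_A(b) = Σ_B β.
    module SourcesInB (t : Fin n) (tA : A t ≡ true) where
      module S = TargetInA t tA
      K Kv D Y : ℕ
      K = S.Kf ωG
      Kv = S.Kf ωGv
      D = K ∸ Kv
      Y = β G t * D

      opaque
        pairTerm-BA : ∀ s → A s ≡ false → pairTerm G v s t ≡ frac (β G s * Y) K
        pairTerm-BA s bs = frac-cross _ _ _ _ (λ e → S.ℓ-ne s (trans (sym (S.σG s)) e)) S.Kf≢0
          (cross-scale (β G s) (β G t) (σv G s t v) K D (σ G s t)
            (trans (cross-∸ (σv G s t v) (S.Wt ωGv (S.ℓ s) s) (S.Wt ωG (S.ℓ s) s) K Kv (S.splitG s) (S.crossB s bs))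
                   (cong (D *_) (sym (S.σG s)))))

        pointwise : ∀ s → (if A s then 0ℚ else pairTerm G v s t) ≡ frac ((if A s then 0 else β G s) * Y) K
        pointwise s with A s in as
        ... | true = sym (frac-0 K)
        ... | false = pairTerm-BA s as

        σGA≢0 : ¬ σ GA' b t ≡ 0
        σGA≢0 e = *≢0 ΣD-pos S.Kf≢0 (trans (sym S.σGA-b) e)

        pairTerm-bA : pairTerm GA' v b t ≡ frac (β GA' b * Y) K
        pairTerm-bA rewrite βGA-A t tA = frac-cross _ _ _ _ σGA≢0 S.Kf≢0
          (cross-scale (β GA' b) (β G t) (σv GA' b t v) K D (σ GA' b t)
            (trans (cross-∸ (σv GA' b t v) (ΣD * Kv) (ΣD * K) K Kv S.splitGA-b
                      (trans (NP.*-assoc ΣD K Kv) (trans (cong (ΣD *_) (NP.*-comm K Kv)) (sym (NP.*-assoc ΣD Kv K)))))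
                   (cong (D *_) (sym S.σGA-b))))

        sum-BA : ∑ℚ (λ s → if A s then 0ℚ else pairTerm G v s t) ≡ pairTerm GA' v b t
        sum-BA = begin
            ∑ℚ (λ s → if A s then 0ℚ else pairTerm G v s t)
          ≡⟨ ∑ℚ-cong pointwise ⟩
            ∑ℚ (λ s → frac ((if A s then 0 else β G s) * Y) K)
          ≡⟨ ∑ℚ-frac (λ s → (if A s then 0 else β G s) * Y) K ⟩
            frac (∑ (λ s → (if A s then 0 else β G s) * Y)) K
          ≡⟨ cong (λ z → frac z K) (trans (sym (*-distribʳ-sum Y (λ s → if A s then 0 else β G s))) (cong (_* Y) (sym βGA-b))) ⟩
            frac (β GA' b * Y) K
          ≡⟨ sym pairTerm-bA ⟩
            pairTerm GA' v b t
          ∎ where open ≡-Reasoning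

    -- κ = [v ∈ C]·α(v): the share of v in the boundary weight ΣC
    κ : ℕ
    κ = if inC v then α G v else 0

    opaque
      pairTerm-BB : ∀ s t → A s ≡ false → (tB : A t ≡ false) → pairTerm G v s t ≡ frac κ ΣC *ℚ pairTerm GB' a s t
      pairTerm-BB s t bs tB rewrite βGB-B s bs | βGB-B t tB | TargetInB.BB-σ t tB s (not-f bs) =
        trans (frac-cross _ _ _ _ σ≢0 (*≢0 ΣC-pos σ≢0) (cross-scale′ (β G s) (β G t) (σv G s t v) ΣC (σ G s t) κ (σv GB' s t a) (TargetInB.BB-rel t tB s (not-f bs))))
              (sym (frac-* κ ΣC _ (σ G s t)))
        where
          σ≢0 : ¬ σ G s t ≡ 0
          σ≢0 e = TargetInB.ℓ-ne t tB s (trans (sym (TargetInB.σG t tB s)) e)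
          cross-scale′ : ∀ p q X C Z k Y → X * C ≡ k * Y → p * q * X * (C * Z) ≡ k * (p * q * Y) * Z
          cross-scale′ p q X C Z k Y e = begin
              p * q * X * (C * Z)
            ≡⟨ solve 5 (λ p q X C Z → p :* q :* X :* (C :* Z) := p :* q :* (X :* C) :* Z) refl p q X C Z ⟩
              p * q * (X * C) * Z
            ≡⟨ cong (λ z → p * q * z * Z) e ⟩
              p * q * (k * Y) * Z
            ≡⟨ solve 5 (λ p q k Y Z → p :* q :* (k :* Y) :* Z := k :* (p :* q :* Y) :* Z) refl p q k Y Z ⟩
              k * (p * q * Y) * Z
            ∎ where open ≡-Reasoning
                    open ℕ-Solver

    ∑² : (Fin n → Fin n → ℚ) → ℚ
    ∑² f = ∑ℚ (λ s → ∑ℚ (λ t → f s t))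

    τG τA τB : Fin n → Fin n → ℚ
    τG s t = pairTerm G v s t
    τA s t = pairTerm GA' v s t
    τB s t = pairTerm GB' a s t

    sum-BB : ℚ
    sum-BB = ∑² (λ s t → if A s then 0ℚ else (if A t then 0ℚ else τB s t))

    F1 F2 F3 F4 E1 E2 E3 E4 : Fin n → Fin n → ℚ
    F1 s t = if A s ∧ A t ∧ not (s == v) ∧ not (t == v) then τG s t else 0ℚ
    F2 s t = if A s ∧ not (s == v) then (if A t then 0ℚ else τG s t) else 0ℚ
    F3 s t = if A t ∧ not (t == v) then (if A s then 0ℚ else τG s t) else 0ℚ
    F4 s t = if A s then 0ℚ else (if A t then 0ℚ else τG s t)
    E1 s t = if A s ∧ A t ∧ not (s == v) ∧ not (t == v) then τA s t else 0ℚ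
    E2 s t = if A s ∧ not (s == v) then (if t == b then τA s t else 0ℚ) else 0ℚ
    E3 s t = if A t ∧ not (t == v) then (if s == b then τA s t else 0ℚ) else 0ℚ
    E4 s t = if s == b then (if t == b then τA s t else 0ℚ) else 0ℚ

    opaque
      ∑²-+ : ∀ f g → ∑² (λ s t → f s t +ℚ g s t) ≡ ∑² f +ℚ ∑² g
      ∑²-+ f g = trans (∑ℚ-cong (λ s → ∑ℚ-+ (f s) (g s))) (∑ℚ-+ (λ s → ∑ℚ (f s)) (λ s → ∑ℚ (g s)))

      blocks-G : ∑² (λ s t → if pairGuard G v s t then τG s t else 0ℚ) ≡ ((∑² F1 +ℚ ∑² F2) +ℚ ∑² F3) +ℚ ∑² F4
      blocks-G = trans (∑ℚ-cong (λ s → ∑ℚ-cong (λ t → pointwise s t)))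
        (trans (∑²-+ (λ s t → (F1 s t +ℚ F2 s t) +ℚ F3 s t) F4) (cong (_+ℚ ∑² F4) (trans (∑²-+ (λ s t → F1 s t +ℚ F2 s t) F3) (cong (_+ℚ ∑² F3) (∑²-+ F1 F2)))))
        where pointwise : ∀ s t → (if pairGuard G v s t then τG s t else 0ℚ) ≡ ((F1 s t +ℚ F2 s t) +ℚ F3 s t) +ℚ F4 s t
              pointwise s t rewrite allv s | allv t = decompose-G (A s) (A t) (s == v) (t == v) (τG s t) (λ bs → ==-≢ (B-≢v s bs)) (λ bt → ==-≢ (B-≢v t bt))

      blocks-GA : ∑² (λ s t → if pairGuard GA' v s t then τA s t else 0ℚ) ≡ ((∑² E1 +ℚ ∑² E2) +ℚ ∑² E3) +ℚ ∑² E4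
      blocks-GA = trans (∑ℚ-cong (λ s → ∑ℚ-cong (λ t → pointwise s t)))
        (trans (∑²-+ (λ s t → (E1 s t +ℚ E2 s t) +ℚ E3 s t) E4) (cong (_+ℚ ∑² E4) (trans (∑²-+ (λ s t → E1 s t +ℚ E2 s t) E3) (cong (_+ℚ ∑² E3) (∑²-+ E1 E2)))))
        where
          is-b⇒∉A : ∀ s → (s == b) ≡ true → A s ≡ false
          is-b⇒∉A s e = subst (λ z → A z ≡ false) (sym (==-≡ e)) b∉A
          is-b⇒≢v : ∀ s → (s == b) ≡ true → (s == v) ≡ false
          is-b⇒≢v s e = ==-≢ (λ q → v≢b (trans (sym q) (==-≡ e)))
          pointwise : ∀ s t → (if pairGuard GA' v s t then τA s t else 0ℚ) ≡ ((E1 s t +ℚ E2 s t) +ℚ E3 s t) +ℚ E4 s t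
          pointwise s t = decompose-GA (A s) (s == b) (s == v) (A t) (t == b) (t == v) (τA s t) (is-b⇒∉A s) (is-b⇒≢v s) (is-b⇒∉A t) (is-b⇒≢v t)

      blocks-GB : ∑² (λ s t → if pairGuard GB' a s t then τB s t else 0ℚ) ≡ sum-BB
      blocks-GB = ∑ℚ-cong (λ s → ∑ℚ-cong (λ t → decompose-GB (A s) (s == a) (A t) (t == a) (τB s t) (c s) (c t)))
        where c : ∀ s → (s == a) ≡ true → A s ≡ true
              c s e = subst (λ z → A z ≡ true) (sym (==-≡ e)) a∈A

      block-AA : ∑² F1 ≡ ∑² E1
      block-AA = ∑ℚ-cong (λ s → ∑ℚ-cong (λ t → pointwise s t (A s) refl (A t) refl))
        where pointwise : ∀ s t x → A s ≡ x → ∀ y → A t ≡ y → F1 s t ≡ E1 s t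
              pointwise s t true as true at rewrite as | at = by-cases (not (s == v) ∧ not (t == v))
                where by-cases : ∀ c → (if c then τG s t else 0ℚ) ≡ (if c then τA s t else 0ℚ)
                      by-cases true = sym (pairTerm-AA s t as at)
                      by-cases false = refl
              pointwise s t true as false at rewrite as | at = refl
              pointwise s t false as y at rewrite as = refl

      block-bb : ∑² E4 ≡ 0ℚ
      block-bb = trans (∑ℚ-cong (λ s → ∑ℚ-guard {n} (s == b) (λ t → if t == b then τA s t else 0ℚ)))
             (trans (∑ℚ-δ b (λ s → ∑ℚ (λ t → if t == b then τA s t else 0ℚ))) (trans (∑ℚ-δ b (λ t → τA b t)) pairTerm-bb))

      block-AB : ∑² F2 ≡ ∑² E2
      block-AB = ∑ℚ-cong pointwise
        where pointwise : ∀ s → ∑ℚ (F2 s) ≡ ∑ℚ (E2 s)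
              pointwise s = trans (∑ℚ-guard {n} (A s ∧ not (s == v)) _) (trans (pointwise′ (A s) refl) (sym (∑ℚ-guard {n} (A s ∧ not (s == v)) _)))
                where pointwise′ : ∀ x → A s ≡ x → (if x ∧ not (s == v) then ∑ℚ (λ t → if A t then 0ℚ else τG s t) else 0ℚ)
                                            ≡ (if x ∧ not (s == v) then ∑ℚ (λ t → if t == b then τA s t else 0ℚ) else 0ℚ)
                      pointwise′ false _ = refl
                      pointwise′ true as = cong (λ z → if not (s == v) then z else 0ℚ)
                         (trans (∑ℚ-cong (λ t → cong (λ z → if A t then 0ℚ else z) (pairTerm-sym-G s t)))
                         (trans (SourcesInB.sum-BA s as) (trans (pairTerm-sym-GA b s) (sym (∑ℚ-δ b (λ t → τA s t))))))

      block-BA : ∑² F3 ≡ ∑² E3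
      block-BA = trans (∑ℚ-comm F3) (trans (∑ℚ-cong pointwise) (sym (∑ℚ-comm E3)))
        where pointwise : ∀ t → ∑ℚ (λ s → F3 s t) ≡ ∑ℚ (λ s → E3 s t)
              pointwise t = trans (∑ℚ-guard {n} (A t ∧ not (t == v)) _) (trans (pointwise′ (A t) refl) (sym (∑ℚ-guard {n} (A t ∧ not (t == v)) _)))
                where pointwise′ : ∀ x → A t ≡ x → (if x ∧ not (t == v) then ∑ℚ (λ s → if A s then 0ℚ else τG s t) else 0ℚ)
                                            ≡ (if x ∧ not (t == v) then ∑ℚ (λ s → if s == b then τA s t else 0ℚ) else 0ℚ)
                      pointwise′ false _ = refl
                      pointwise′ true at = cong (λ z → if not (t == v) then z else 0ℚ)
                         (trans (SourcesInB.sum-BA t at) (sym (∑ℚ-δ b (λ s → τA s t))))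

      block-BB : ∑² F4 ≡ frac κ ΣC *ℚ sum-BB
      block-BB = trans (∑ℚ-cong (λ s → trans (∑ℚ-cong (λ t → pointwise s t (A s) refl (A t) refl)) (sym (∑ℚ-*ˡ (frac κ ΣC) (λ t → if A s then 0ℚ else (if A t then 0ℚ else τB s t))))))
                  (sym (∑ℚ-*ˡ (frac κ ΣC) (λ s → ∑ℚ (λ t → if A s then 0ℚ else (if A t then 0ℚ else τB s t)))))
        where pointwise : ∀ s t x → A s ≡ x → ∀ y → A t ≡ y → F4 s t ≡ frac κ ΣC *ℚ (if A s then 0ℚ else (if A t then 0ℚ else τB s t))
              pointwise s t true as y at rewrite as = sym (QP.*-zeroʳ (frac κ ΣC))
              pointwise s t false as true at rewrite as | at = sym (QP.*-zeroʳ (frac κ ΣC))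
              pointwise s t false as false at rewrite as | at = pairTerm-BB s t as at

      α-GA-v : α GA' v ≡ α G v
      α-GA-v rewrite ==-≢ v≢b = refl

      α-GB-a : α GB' a ≡ ΣC
      α-GB-a rewrite ==-refl a = refl

      combine : ∀ (c : Bool) (p R Y q : ℚ) → p *ℚ frac (if c then α G v else 0) ΣC ≡ (if c then q else 0ℚ) →
        p *ℚ (R +ℚ frac (if c then α G v else 0) ΣC *ℚ Y) ≡ p *ℚ (R +ℚ 0ℚ) +ℚ (if c then 1ℚ else 0ℚ) *ℚ (q *ℚ Y)
      combine true p R Y q e = trans (solve 4 (λ p R f Y → p :* (R :+ f :* Y) := p :* R :+ (p :* f) :* Y) refl p R (frac (α G v) ΣC) Y)
         (trans (cong (λ z → p *ℚ R +ℚ z *ℚ Y) e) (solve 4 (λ p R q Y → p :* R :+ q :* Y := p :* (R :+ con 0ℚ) :+ con 1ℚ :* (q :* Y)) refl p R q Y))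
        where open ℚ-Solver
      combine false p R Y q e rewrite frac-0 ΣC = solve 4 (λ p R Y q → p :* (R :+ con 0ℚ :* Y) := p :* (R :+ con 0ℚ) :+ con 0ℚ :* (q :* Y)) refl p R Y q
        where open ℚ-Solver

      κ-ratio : frac 1 (α G v) *ℚ frac κ ΣC ≡ (if inC v then frac 1 ΣC else 0ℚ)
      κ-ratio with inC v
      ... | true = trans (frac-* 1 (α G v) (α G v) ΣC) (frac-cross _ _ _ _ (*≢0 (pos v) ΣC-pos) ΣC-pos
                      (trans (cong (_* ΣC) (NP.*-identityˡ (α G v))) (sym (NP.*-identityˡ (α G v * ΣC)))))
      ... | false = trans (cong (frac 1 (α G v) *ℚ_) (frac-0 ΣC)) (QP.*-zeroʳ (frac 1 (α G v)))

      sum-G : ∑² (λ s t → if pairGuard G v s t then τG s t else 0ℚ) ≡ ((∑² E1 +ℚ ∑² E2) +ℚ ∑² E3) +ℚ frac κ ΣC *ℚ sum-BB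
      sum-G = trans blocks-G (cong₂ _+ℚ_ (cong₂ _+ℚ_ (cong₂ _+ℚ_ block-AA block-AB) block-BA) block-BB)

      sum-GA : ∑² (λ s t → if pairGuard GA' v s t then τA s t else 0ℚ) ≡ ((∑² E1 +ℚ ∑² E2) +ℚ ∑² E3) +ℚ 0ℚ
      sum-GA = trans blocks-GA (cong (((∑² E1 +ℚ ∑² E2) +ℚ ∑² E3) +ℚ_) block-bb)

lemma9 : (n : ℕ) (G : WGraph n) →
    (∀ v → vert G v ≡ true) → IsSimple (adj G) → Connected G →
    (∀ v → NonZero (α G v)) →
    (A : Fin n → Bool) → IsSplit (adj G) A →
    (a b : Fin n) → T (inN (adj G) (λ x → not (A x)) a) → T (inN (adj G) A b) →
    (v : Fin n) → T (A v) →
    BC G v ≡ BC (GA G A b) v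
      +ℚ ((if inN (adj G) (λ x → not (A x)) v then 1ℚ else 0ℚ) *ℚ BC (GB G A a) a)
lemma9 n G allv simple conn nz A split a b aC bD v vA = begin
  BC G v
    ≡⟨ BC-double-sum G v ⟩
  frac 1 (α G v) *ℚ ∑² (λ s t → if pairGuard G v s t then τG s t else 0ℚ)
    ≡⟨ Eq.cong (frac 1 (α G v) *ℚ_) sum-G ⟩
  frac 1 (α G v) *ℚ (R +ℚ frac κ ΣC *ℚ sum-BB)
    ≡⟨ combine (inC v) (frac 1 (α G v)) R sum-BB (frac 1 ΣC) κ-ratio ⟩
  frac 1 (α G v) *ℚ (R +ℚ 0ℚ) +ℚ [v∈C] *ℚ (frac 1 ΣC *ℚ sum-BB)
    ≡⟨ Eq.cong₂ (λ x y → x +ℚ [v∈C] *ℚ y)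
             (Eq.cong₂ _*ℚ_ (Eq.cong (frac 1) (Eq.sym α-GA-v)) (Eq.sym sum-GA))
             (Eq.cong₂ _*ℚ_ (Eq.cong (frac 1) (Eq.sym α-GB-a)) (Eq.sym blocks-GB)) ⟩
  frac 1 (α GA' v) *ℚ ∑² (λ s t → if pairGuard GA' v s t then τA s t else 0ℚ)
    +ℚ [v∈C] *ℚ (frac 1 (α GB' a) *ℚ ∑² (λ s t → if pairGuard GB' a s t then τB s t else 0ℚ))
    ≡⟨ Eq.cong₂ (λ x y → x +ℚ [v∈C] *ℚ y) (BC-double-sum GA' v) (BC-double-sum GB' a) ⟨
  BC GA' v +ℚ [v∈C] *ℚ BC GB' a ∎
  where
  open Comparison
  open Contributions G allv simple conn nz A split a b aC bD v vA
  open Eq.≡-Reasoning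
  R : ℚ
  R = (∑² E1 +ℚ ∑² E2) +ℚ ∑² E3
  [v∈C] : ℚ
  [v∈C] = if inC v then 1ℚ else 0ℚ
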